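{- Let $n\geq 5$. For every spanning tree $G$ of $C_n^2$ there exists a unique nontrivial connected spanning convex subgraph $H$ of $C_n^2$ such that $E(G)\subseteq E(H)$. More precisely, denoting by $T_X$ the set of spanning trees of a graph $X$, \[ T_{C_n^2}=\bigcup_{k=0}^{\lceil\frac{n-2}{2}\rceil}\ \bigcup_{j=0}^{n-1} T_{S_{n,k,j}}, \] and this union is disjoint.
   Context: For $n\geq 5$, the square cycle $C_n^2$ has vertex set $\mathbb{Z}_n=\mathbb{Z}/n\mathbb{Z}$, with $v_i=i+n\mathbb{Z}$ for $i\in\mathbb{Z}$, and edge set $\{\{v_i,v_j\}: i-j\in\{1,2\}\}$. For $i\in\mathbb{Z}$ write $e_i=\{v_i,v_{i+1}\}$ (frames) and $f_i=\{v_i,v_{i+2}\}$ (windows), indices modulo $n$. A spanning subgraph has vertex set all of $\mathbb{Z}_n$; a spanning tree is a spanning subgraph which is a tree. The triangles are $T_i=\{e_i,e_{i+1},f_i\}$; a subgraph $G$ is convex if for every $i$, either $|T_i\cap E(G)|\leq1$ or $T_i\subseteq E(G)$. The trivial connected spanning subgraphs are $C_n^2$ itself and, when $n$ is odd, the graph $(\mathbb{Z}_n,\{f_0,\dots,f_{n-1}\})$; "nontrivial" means not one of these. For integers $j,k$ with $0\leq k\leq\lceil\frac{n-2}{2}\rceil$, $S_{n,k,j}$ is the graph with vertex set $\mathbb{Z}_n$ and edge set $E(C_n^2)\setminus\big(\{f_j,f_{j+2k+1}\}\cup\{e_{j+1},\dots,e_{j+2k+1}\}\big)$. -}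

module Defs where

open import Data.Nat using (ℕ; zero; suc; _+_; _*_; _∸_; _≤_; _%_; NonZero; ⌈_/2⌉)
open import Data.Nat.DivMod using (_mod_)
open import Data.Fin using (Fin; toℕ)
open import Data.Bool using (Bool; true; false)
open import Data.Product using (Σ; _×_; _,_)
open import Data.Sum using (_⊎_)
open import Relation.Binary.PropositionalEquality using (_≡_; _≢_)
open import Relation.Binary.Construct.Closure.ReflexiveTransitive using (Star)
open import Relation.Nullary using (¬_)
open import Function.Definitions using (Injective)

_+ᵥ_ : {n : ℕ} {{_ : NonZero n}} → Fin n → ℕ → Fin n
_+ᵥ_ {n} v k = (toℕ v + k) mod n

-- Edges of C_n^2 : frames e_i = {v_i, v_{i+1}} and windows f_i = {v_i, v_{i+2}}.
-- (For n ≥ 5 these 2n edges are pairwise distinct.)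
data Edge (n : ℕ) : Set where
  frame  : Fin n → Edge n
  window : Fin n → Edge n

src tgt : {n : ℕ} {{_ : NonZero n}} → Edge n → Fin n
src (frame i)  = i
src (window i) = i
tgt (frame i)  = i +ᵥ 1
tgt (window i) = i +ᵥ 2

-- A spanning subgraph of C_n^2 is given by its edge set (vertex set is all of Z_n).
Subgraph : ℕ → Set
Subgraph n = Edge n → Bool

_⊆ᴱ_ : {n : ℕ} → Subgraph n → Subgraph n → Set
G ⊆ᴱ H = ∀ x → G x ≡ true → H x ≡ true

Adj : {n : ℕ} {{_ : NonZero n}} → Subgraph n → Fin n → Fin n → Set
Adj {n} G u v = Σ (Edge n) λ x → G x ≡ true ×
  ((src x ≡ u × tgt x ≡ v) ⊎ (src x ≡ v × tgt x ≡ u))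

Connected : {n : ℕ} {{_ : NonZero n}} → Subgraph n → Set
Connected G = ∀ u v → Star (Adj G) u v

HasCycle : {n : ℕ} {{_ : NonZero n}} → Subgraph n → Set
HasCycle {n} G = Σ ℕ λ m → Σ (Fin (3 + m) → Fin n) λ c →
  Injective _≡_ _≡_ c × (∀ (i : Fin (3 + m)) → Adj G (c i) (c (i +ᵥ 1)))

Acyclic : {n : ℕ} {{_ : NonZero n}} → Subgraph n → Set
Acyclic G = ¬ HasCycle G

IsTree : {n : ℕ} {{_ : NonZero n}} → Subgraph n → Set
IsTree G = Connected G × Acyclic G

b2n : Bool → ℕ
b2n true  = 1
b2n false = 0

triCount : {n : ℕ} {{_ : NonZero n}} → Subgraph n → Fin n → ℕ
triCount G i = b2n (G (frame i)) + b2n (G (frame (i +ᵥ 1))) + b2n (G (window i))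

Convex : {n : ℕ} {{_ : NonZero n}} → Subgraph n → Set
Convex G = ∀ i → triCount G i ≤ 1 ⊎
  (G (frame i) ≡ true × G (frame (i +ᵥ 1)) ≡ true × G (window i) ≡ true)

-- trivial connected spanning subgraphs
IsFull : {n : ℕ} → Subgraph n → Set
IsFull G = ∀ x → G x ≡ true

IsWindowCycle : {n : ℕ} → Subgraph n → Set
IsWindowCycle G = ∀ i → G (window i) ≡ true × G (frame i) ≡ false

Nontrivial : {n : ℕ} → Subgraph n → Set
Nontrivial {n} G = ¬ IsFull G × (n % 2 ≡ 1 → ¬ IsWindowCycle G)

kmax : ℕ → ℕ
kmax n = ⌈ n ∸ 2 /2⌉

InS : {n : ℕ} {{_ : NonZero n}} → ℕ → Fin n → Edge n → Set
InS k j x = x ≢ window j × x ≢ window (j +ᵥ (2 * k + 1)) ×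
  (∀ t → 1 ≤ t → t ≤ 2 * k + 1 → x ≢ frame (j +ᵥ t))

SpanningTreeOfS : {n : ℕ} {{_ : NonZero n}} → ℕ → Fin n → Subgraph n → Set
SpanningTreeOfS k j G = (∀ x → G x ≡ true → InS k j x) × IsTree G

{-# OPTIONS --safe #-}
-- Lift C_n^2 to its universal cover: position p ∈ ℕ stands for the vertex p mod n, frames join p
-- to p + 1 and windows join p to p + 2. A walk in an acyclic graph cannot wind around the cycle,
-- because a closed walk in a forest has displacement 0. Sweeping upwards from a present frame e_a,
-- a spanning tree G therefore fails to reach a + n, and the sweep can only stop at a missing window
-- f_j followed by an odd run of missing frames e_{j+1}, ..., e_{j+d} and the missing window f_{j+d};
-- that is, G ⊆ S_{n,k,j} with d = 2k + 1 (a tree without frames misses a window on each cycle of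
-- windows, and suitable missing windows bound the gap).
-- Conversely S_{n,k,j} has an integer potential increasing by the length of each of its edges.
-- Potentials of a connected spanning graph differ by a constant, so a connected graph inside
-- S_{n,k,j} and S_{n,k',j'} makes each edge of one fit the potential of the other, which forces
-- (k, j) = (k', j'). Finally, in a nontrivial connected convex H every triangle is empty, has one
-- edge, or is full; a parity labelling rules out even runs of missing frames, so the missing frames
-- after any frame-end of H form an odd run bounded by missing windows, and H = S_{n,k,j}.

module Submission where

open import Defs
open import Data.Nat using (ℕ; zero; suc; s≤s⁻¹; _+_; _*_; _∸_; _≤_; _<_; _%_; _/_; NonZero; z≤n; s≤s; _≟_; _≤?_; _<?_; ⌊_/2⌋; ⌈_/2⌉; >-nonZero⁻¹)
open import Data.Nat.Properties
open import Data.Nat.DivMod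
open import Data.Bool using (Bool; true; false; not)
open import Data.Bool.Properties using (not-injective; ¬-not)
open import Data.Fin using (Fin; toℕ)
import Data.Fin.Properties as FP
open import Data.Product using (Σ; ∃; _×_; _,_; proj₁; proj₂)
open import Data.Sum using (_⊎_; inj₁; inj₂)
open import Data.Empty using (⊥; ⊥-elim)
open import Data.Unit using (⊤; tt)
open import Data.List using (List; []; _∷_)
open import Data.List.Membership.Propositional using (_∈_; _∉_)
open import Data.List.Relation.Unary.Any using (here; there)
open import Relation.Nullary using (¬_; Dec; yes; no; does; ¬?; _×-dec_)
open import Relation.Nullary.Decidable using (map′; ⌊_⌋; isYes≗does; dec-true; dec-false; does-⇔)
open import Function.Bundles using (_⇔_; mk⇔; Equivalence)
open Equivalence using (to; from)
open import Relation.Binary.PropositionalEquality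
open import Relation.Binary.Definitions using (tri<; tri≈; tri>)
open import Relation.Binary.Construct.Closure.ReflexiveTransitive using (Star; ε; _◅_; _◅◅_; reverse)
open import Data.Nat.Tactic.RingSolver using (solve-∀)
open import Data.Integer as ℤ using (ℤ; -_) renaming (_+_ to _+ℤ_)
import Data.Integer.Properties as ℤₚ
open import Data.Integer.Tactic.RingSolver using () renaming (solve-∀ to ℤ-solve-∀)

-- Arithmetic modulo n

module ZMod (n : ℕ) {{_ : NonZero n}} where

  ⟦_⟧ : ℕ → Fin n
  ⟦ p ⟧ = p mod n

  toℕ-⟦⟧ : ∀ p → toℕ ⟦ p ⟧ ≡ p % n
  toℕ-⟦⟧ p = FP.toℕ-fromℕ< _

  %≡⇒⟦⟧≡ : ∀ {p q} → p % n ≡ q % n → ⟦ p ⟧ ≡ ⟦ q ⟧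
  %≡⇒⟦⟧≡ {p} {q} e = FP.toℕ-injective (trans (toℕ-⟦⟧ p) (trans e (sym (toℕ-⟦⟧ q))))

  ⟦⟧≡⇒%≡ : ∀ {p q} → ⟦ p ⟧ ≡ ⟦ q ⟧ → p % n ≡ q % n
  ⟦⟧≡⇒%≡ {p} {q} e = trans (sym (toℕ-⟦⟧ p)) (trans (cong toℕ e) (toℕ-⟦⟧ q))

  ⟦toℕ⟧ : ∀ (v : Fin n) → ⟦ toℕ v ⟧ ≡ v
  ⟦toℕ⟧ v = FP.toℕ-injective (trans (toℕ-⟦⟧ (toℕ v)) (m<n⇒m%n≡m (FP.toℕ<n v)))

  ⟦p+n⟧ : ∀ p → ⟦ p + n ⟧ ≡ ⟦ p ⟧
  ⟦p+n⟧ p = %≡⇒⟦⟧≡ ([m+n]%n≡m%n p n)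

  ⟦+n⟧≡⟦+0⟧ : ∀ p → ⟦ p + n ⟧ ≡ ⟦ p + 0 ⟧
  ⟦+n⟧≡⟦+0⟧ p = trans (⟦p+n⟧ p) (cong ⟦_⟧ (sym (+-identityʳ p)))

  ⟦toℕ+0⟧ : ∀ (v : Fin n) → ⟦ toℕ v + 0 ⟧ ≡ v
  ⟦toℕ+0⟧ v = trans (cong ⟦_⟧ (+-identityʳ (toℕ v))) (⟦toℕ⟧ v)

  ⟦toℕ+n⟧ : ∀ (v : Fin n) → ⟦ toℕ v + n ⟧ ≡ v
  ⟦toℕ+n⟧ v = trans (⟦p+n⟧ (toℕ v)) (⟦toℕ⟧ v)

  ⟦⟧+ᵥ : ∀ p k → ⟦ p ⟧ +ᵥ k ≡ ⟦ p + k ⟧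
  ⟦⟧+ᵥ p k = %≡⇒⟦⟧≡ (begin
      (toℕ ⟦ p ⟧ + k) % n      ≡⟨ cong (λ z → (z + k) % n) (toℕ-⟦⟧ p) ⟩
      (p % n + k) % n          ≡⟨ %-distribˡ-+ (p % n) k n ⟩
      (p % n % n + k % n) % n  ≡⟨ cong (λ z → (z + k % n) % n) (m%n%n≡m%n p n) ⟩
      (p % n + k % n) % n      ≡⟨ sym (%-distribˡ-+ p k n) ⟩
      (p + k) % n              ∎)
    where open ≡-Reasoning

  ⟦⟧+ᵥ1 : ∀ p → ⟦ p ⟧ +ᵥ 1 ≡ ⟦ suc p ⟧
  ⟦⟧+ᵥ1 p = trans (⟦⟧+ᵥ p 1) (cong ⟦_⟧ (+-comm p 1))

  +ᵥ-assoc : ∀ (v : Fin n) a b → (v +ᵥ a) +ᵥ b ≡ v +ᵥ (a + b)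
  +ᵥ-assoc v a b = trans (⟦⟧+ᵥ (toℕ v + a) b) (cong ⟦_⟧ (+-assoc (toℕ v) a b))

  ⟦⟧≡⇒≡+multiple : ∀ {p q} → p ≤ q → ⟦ p ⟧ ≡ ⟦ q ⟧ → ∃ λ c → q ≡ p + c * n
  ⟦⟧≡⇒≡+multiple {p} {q} p≤q e = q / n ∸ p / n , (begin
      q                                   ≡⟨ m≡m%n+[m/n]*n q n ⟩
      q % n + q / n * n                   ≡⟨ cong (_+ q / n * n) (sym (⟦⟧≡⇒%≡ e)) ⟩
      p % n + q / n * n                   ≡⟨ cong (λ z → p % n + z * n) (sym (m+[n∸m]≡n p/n≤q/n)) ⟩
      p % n + (p / n + c) * n             ≡⟨ cong (p % n +_) (*-distribʳ-+ n (p / n) c) ⟩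
      p % n + (p / n * n + c * n)         ≡⟨ sym (+-assoc (p % n) (p / n * n) (c * n)) ⟩
      p % n + p / n * n + c * n           ≡⟨ cong (_+ c * n) (sym (m≡m%n+[m/n]*n p n)) ⟩
      p + c * n                           ∎)
    where
    open ≡-Reasoning
    p/n≤q/n : p / n ≤ q / n
    p/n≤q/n = /-monoˡ-≤ n p≤q
    c : ℕ
    c = q / n ∸ p / n

  ⟦⟧-injective-window : ∀ {p q} → p ≤ q → q < p + n → ⟦ p ⟧ ≡ ⟦ q ⟧ → p ≡ q
  ⟦⟧-injective-window {p} {q} p≤q q<p+n e with ⟦⟧≡⇒≡+multiple p≤q e
  ... | zero , eq = trans (sym (+-identityʳ p)) (sym eq)
  ... | suc c , eq = ⊥-elim (<⇒≱ q<p+n (begin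
        p + n          ≤⟨ +-monoʳ-≤ p (m≤m+n n (c * n)) ⟩
        p + suc c * n  ≡⟨ sym eq ⟩
        q              ∎))
    where open ≤-Reasoning

  ⟦+⟧-injective-≤ : ∀ b {o o'} → o ≤ o' → o' < o + n → ⟦ b + o ⟧ ≡ ⟦ b + o' ⟧ → o ≡ o'
  ⟦+⟧-injective-≤ b {o} {o'} o≤o' o'<o+n e =
    +-cancelˡ-≡ b o o' (⟦⟧-injective-window (+-monoʳ-≤ b o≤o')
      (subst (b + o' <_) (sym (+-assoc b o n)) (+-monoʳ-< b o'<o+n)) e)

  ⟦+⟧-injective : ∀ b {o o'} → o < o' + n → o' < o + n → ⟦ b + o ⟧ ≡ ⟦ b + o' ⟧ → o ≡ o'
  ⟦+⟧-injective b {o} {o'} o<o'+n o'<o+n e with ≤-total o o'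
  ... | inj₁ o≤o' = ⟦+⟧-injective-≤ b o≤o' o'<o+n e
  ... | inj₂ o'≤o = sym (⟦+⟧-injective-≤ b o'≤o o<o'+n (sym e))

  ⟦+⟧-injective₁ : ∀ b {o o'} → 1 ≤ o → 1 ≤ o' → o ≤ n → o' ≤ n → ⟦ b + o ⟧ ≡ ⟦ b + o' ⟧ → o ≡ o'
  ⟦+⟧-injective₁ b {o} {o'} 1≤o 1≤o' o≤n o'≤n =
    ⟦+⟧-injective b (≤-<-trans o≤n (m<n+m n 1≤o')) (≤-<-trans o'≤n (m<n+m n 1≤o))

  ⟦+⟧≡⟦⟧⇒≡n : ∀ b {x} → 1 ≤ x → x < n + n → ⟦ b + x ⟧ ≡ ⟦ b ⟧ → x ≡ n
  ⟦+⟧≡⟦⟧⇒≡n b {x} 1≤x x<2n e =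
    ⟦+⟧-injective b x<2n (m<n+m n 1≤x) (trans e (sym (⟦p+n⟧ b)))

  +ᵥ≡self⇒≡n : ∀ (v : Fin n) {d} → 1 ≤ d → d ≤ n → v +ᵥ d ≡ v → d ≡ n
  +ᵥ≡self⇒≡n v 1≤d d≤n e = ⟦+⟧≡⟦⟧⇒≡n (toℕ v) 1≤d (≤-<-trans d≤n (m<m+n n (>-nonZero⁻¹ n))) (trans e (sym (⟦toℕ⟧ v)))

  ⟦⟧≢⟦+⟧ : ∀ p {k} → 0 < k → k < n → ⟦ p ⟧ ≢ ⟦ p + k ⟧
  ⟦⟧≢⟦+⟧ p {k} 0<k k<n e =
    <⇒≢ (m<m+n p 0<k) (⟦⟧-injective-window (m≤m+n p k) (+-monoʳ-< p k<n) e)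

  +ᵥ-≢ : ∀ (v : Fin n) {k} → 0 < k → k < n → v +ᵥ k ≢ v
  +ᵥ-≢ v 0<k k<n e = ⟦⟧≢⟦+⟧ (toℕ v) 0<k k<n (trans (⟦toℕ⟧ v) (sym e))

  <-or-wraps : ∀ {o} k → o < n → o + k < n ⊎ Σ ℕ λ r → r < k × o + k ≡ n + r
  <-or-wraps {o} k o<n with o + k <? n
  ... | yes o+k<n = inj₁ o+k<n
  ... | no o+k≮n = inj₂ (o + k ∸ n , r<k , sym (m+[n∸m]≡n n≤o+k))
    where
    n≤o+k : n ≤ o + k
    n≤o+k = ≮⇒≥ o+k≮n
    r<k : o + k ∸ n < k
    r<k = subst (o + k ∸ n <_) (m+n∸m≡n n k) (∸-monoˡ-< (+-monoˡ-< k o<n) n≤o+k)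

  offset : Fin n → Fin n → ℕ
  offset j v with toℕ j ≤? toℕ v
  ... | yes _ = toℕ v ∸ toℕ j
  ... | no _ = toℕ v + n ∸ toℕ j

  offset<n : ∀ j v → offset j v < n
  offset<n j v with toℕ j ≤? toℕ v
  ... | yes _ = ≤-<-trans (m∸n≤m (toℕ v) (toℕ j)) (FP.toℕ<n v)
  ... | no j≰v = subst (toℕ v + n ∸ toℕ j <_) (m+n∸n≡m n (toℕ j))
      (∸-monoˡ-< (subst (toℕ v + n <_) (+-comm (toℕ j) n) (+-monoˡ-< n (≰⇒> j≰v)))
                 (≤-trans (<⇒≤ (FP.toℕ<n j)) (m≤n+m n (toℕ v))))

  ⟦+offset⟧ : ∀ j v → ⟦ toℕ j + offset j v ⟧ ≡ v
  ⟦+offset⟧ j v with toℕ j ≤? toℕ v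
  ... | yes j≤v = trans (cong ⟦_⟧ (m+[n∸m]≡n j≤v)) (⟦toℕ⟧ v)
  ... | no _ = trans (cong ⟦_⟧ (m+[n∸m]≡n (≤-trans (<⇒≤ (FP.toℕ<n j)) (m≤n+m n (toℕ v)))))
                     (trans (⟦p+n⟧ (toℕ v)) (⟦toℕ⟧ v))

  ⟦p+offset⟧ : ∀ p v → ⟦ p + offset ⟦ p ⟧ v ⟧ ≡ v
  ⟦p+offset⟧ p v = trans (sym (⟦⟧+ᵥ p _)) (⟦+offset⟧ ⟦ p ⟧ v)

  offset≡⇒≡ : ∀ j {v t} → offset j v ≡ t → v ≡ ⟦ toℕ j + t ⟧
  offset≡⇒≡ j {v} refl = sym (⟦+offset⟧ j v)

  offset-⟦+⟧ : ∀ j {o} → o < n → offset j ⟦ toℕ j + o ⟧ ≡ o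
  offset-⟦+⟧ j {o} o<n = ⟦+⟧-injective (toℕ j) (<-≤-trans (offset<n j _) (m≤n+m n o))
    (<-≤-trans o<n (m≤n+m n _)) (⟦+offset⟧ j ⟦ toℕ j + o ⟧)

  offset-+ᵥ : ∀ j {o k} → o + k < n → offset j (⟦ toℕ j + o ⟧ +ᵥ k) ≡ o + k
  offset-+ᵥ j {o} {k} o+k<n =
    trans (cong (offset j) (trans (⟦⟧+ᵥ (toℕ j + o) k) (cong ⟦_⟧ (+-assoc (toℕ j) o k)))) (offset-⟦+⟧ j o+k<n)

  offset-+ᵥ-wrap : ∀ j {o k r} → o + k ≡ n + r → r < n → offset j (⟦ toℕ j + o ⟧ +ᵥ k) ≡ r
  offset-+ᵥ-wrap j {o} {k} {r} e r<n = trans (cong (offset j) wraps) (offset-⟦+⟧ j r<n)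
    where
    b : ℕ
    b = toℕ j
    wraps : ⟦ b + o ⟧ +ᵥ k ≡ ⟦ b + r ⟧
    wraps = begin
      ⟦ b + o ⟧ +ᵥ k   ≡⟨ ⟦⟧+ᵥ (b + o) k ⟩
      ⟦ b + o + k ⟧    ≡⟨ cong ⟦_⟧ (trans (+-assoc b o k) (cong (b +_) (trans e (+-comm n r)))) ⟩
      ⟦ b + (r + n) ⟧  ≡⟨ cong ⟦_⟧ (sym (+-assoc b r n)) ⟩
      ⟦ b + r + n ⟧    ≡⟨ ⟦p+n⟧ (b + r) ⟩
      ⟦ b + r ⟧        ∎
      where open ≡-Reasoning

-- Parity

Even Odd : ℕ → Set
Even o = ∃ λ q → o ≡ 2 * q
Odd o = ∃ λ q → o ≡ 2 * q + 1

even⇒%2≡0 : ∀ {o} → Even o → o % 2 ≡ 0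
even⇒%2≡0 (q , refl) = trans (cong (_% 2) (*-comm 2 q)) (m*n%n≡0 q 2)

odd⇒%2≡1 : ∀ {o} → Odd o → o % 2 ≡ 1
odd⇒%2≡1 (q , refl) = trans (cong (_% 2) (trans (+-comm (2 * q) 1) (cong (1 +_) (*-comm 2 q)))) ([m+kn]%n≡m%n 1 q 2)

even∧odd⇒⊥ : ∀ {o} → Even o → Odd o → ⊥
even∧odd⇒⊥ even odd = 0≢1+n (trans (sym (even⇒%2≡0 even)) (odd⇒%2≡1 odd))

even⇒odd-suc : ∀ {o} → Even o → Odd (suc o)
even⇒odd-suc (q , refl) = q , sym (+-comm (2 * q) 1)

odd⇒even-suc : ∀ {o} → Odd o → Even (suc o)
odd⇒even-suc (q , refl) = suc q , 1+[2q+1]≡2[1+q] q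
  where
  1+[2q+1]≡2[1+q] : ∀ q → suc (2 * q + 1) ≡ 2 * suc q
  1+[2q+1]≡2[1+q] = solve-∀

even-or-odd : ∀ o → Even o ⊎ Odd o
even-or-odd zero = inj₁ (0 , refl)
even-or-odd (suc o) with even-or-odd o
... | inj₁ even = inj₂ (even⇒odd-suc even)
... | inj₂ odd = inj₁ (odd⇒even-suc odd)

even? : ∀ o → Dec (Even o)
even? o with even-or-odd o
... | inj₁ even = yes even
... | inj₂ odd = no (λ even → even∧odd⇒⊥ even odd)

even-+2 : ∀ {o} → Even o → Even (o + 2)
even-+2 {o} even = subst Even (+-comm 2 o) (odd⇒even-suc (even⇒odd-suc even))

odd-+2 : ∀ {o} → Odd o → Odd (o + 2)
odd-+2 {o} odd = subst Odd (+-comm 2 o) (even⇒odd-suc (odd⇒even-suc odd))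

even-+2⁻¹ : ∀ {o} → Even (o + 2) → Even o
even-+2⁻¹ {o} even with even-or-odd o
... | inj₁ even-o = even-o
... | inj₂ odd-o = ⊥-elim (even∧odd⇒⊥ even (odd-+2 odd-o))

odd⇒0< : ∀ {o} → Odd o → 0 < o
odd⇒0< (q , refl) = m≤n+m 1 (2 * q)

even-≤-odd⇒< : ∀ {o d} → Even o → Odd d → o ≤ d → o < d
even-≤-odd⇒< even odd o≤d with m≤n⇒m<n∨m≡n o≤d
... | inj₁ o<d = o<d
... | inj₂ refl = ⊥-elim (even∧odd⇒⊥ even odd)

odd-<-odd⇒+2≤ : ∀ {o d} → Odd o → Odd d → o < d → o + 2 ≤ d
odd-<-odd⇒+2≤ {o} {d} odd odd' o<d =
  subst (_≤ d) (+-comm 2 o) (even-≤-odd⇒< (odd⇒even-suc odd) odd' o<d)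

odd∸odd : ∀ {i d} → Odd i → Odd d → Even (d ∸ i)
odd∸odd (a , refl) (b , refl) = b ∸ a , (begin
  2 * b + 1 ∸ (2 * a + 1)  ≡⟨ cong₂ _∸_ (+-comm (2 * b) 1) (+-comm (2 * a) 1) ⟩
  1 + 2 * b ∸ (1 + 2 * a)  ≡⟨ [m+n]∸[m+o]≡n∸o 1 (2 * b) (2 * a) ⟩
  2 * b ∸ 2 * a            ≡⟨ sym (*-distribˡ-∸ 2 b a) ⟩
  2 * (b ∸ a)              ∎)
  where open ≡-Reasoning

even-≢0⇒2≤ : ∀ {o} → Even o → o ≢ 0 → 2 ≤ o
even-≢0⇒2≤ (zero , refl) o≢0 = ⊥-elim (o≢0 refl)
even-≢0⇒2≤ (suc q , refl) _ = subst (2 ≤_) (sym (*-suc 2 q)) (m≤m+n 2 _)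

gap : ℕ → ℕ
gap k = 2 * k + 1

gap-odd : ∀ k → Odd (gap k)
gap-odd k = k , refl

1≤gap : ∀ k → 1 ≤ gap k
1≤gap k = m≤n+m 1 (2 * k)

gap-injective : ∀ {k k'} → gap k ≡ gap k' → k ≡ k'
gap-injective {k} {k'} e = *-cancelˡ-≡ k k' 2 (+-cancelʳ-≡ 1 (2 * k) (2 * k') e)

gap<2* : ∀ {r h} → r < h → gap r < 2 * h
gap<2* {r} {h} r<h = subst (_≤ 2 * h) (2[1+r]≡1+[2r+1] r) (*-monoʳ-≤ 2 r<h)
  where
  2[1+r]≡1+[2r+1] : ∀ r → 2 * suc r ≡ suc (2 * r + 1)
  2[1+r]≡1+[2r+1] = solve-∀

gap≤⇒≤kmax : ∀ {k n} → gap k ≤ n → k ≤ kmax n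
gap≤⇒≤kmax {k} {zero} gap≤ with ≤-trans (1≤gap k) gap≤
... | ()
gap≤⇒≤kmax {k} {suc m} gap≤ = subst (_≤ kmax (suc m)) (sym (n≡⌊n+n/2⌋ k)) (⌊n/2⌋-mono (begin
  k + k          ≡⟨ cong (k +_) (sym (+-identityʳ k)) ⟩
  2 * k          ≤⟨ s≤s⁻¹ (subst (_≤ suc m) (+-comm (2 * k) 1) gap≤) ⟩
  m              ≤⟨ m≤n+m∸n m 1 ⟩
  suc (m ∸ 1)    ∎))
  where open ≤-Reasoning

≤kmax⇒gap≤ : ∀ {k n} → 1 ≤ n → k ≤ kmax n → gap k ≤ n
≤kmax⇒gap≤ {k} {suc zero} _ z≤n = ≤-refl
≤kmax⇒gap≤ {k} {suc (suc m)} _ k≤ = subst (_≤ suc (suc m)) (+-comm 1 (2 * k)) (s≤s (begin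
  2 * k                        ≡⟨ cong (k +_) (+-identityʳ k) ⟩
  k + k                        ≤⟨ +-mono-≤ k≤ (≤-trans k≤ (⌊n/2⌋≤⌈n/2⌉ (suc m))) ⟩
  ⌊ suc m /2⌋ + ⌈ suc m /2⌉    ≡⟨ ⌊n/2⌋+⌈n/2⌉≡n (suc m) ⟩
  suc m                        ∎))
  where open ≤-Reasoning

least-false : (f : ℕ → Bool) → ∀ N → (∀ i → i < N → f i ≡ true) ⊎
  Σ ℕ λ i → i < N × f i ≡ false × (∀ i' → i' < i → f i' ≡ true)
least-false f zero = inj₁ (λ i ())
least-false f (suc N) with least-false f N | f N in fN
... | inj₂ (i , i<N , fi , below) | _ = inj₂ (i , m≤n⇒m≤1+n i<N , fi , below)
... | inj₁ below | false = inj₂ (N , ≤-refl , fN , below)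
... | inj₁ below | true = inj₁ below-suc
  where
  below-suc : ∀ i → i < suc N → f i ≡ true
  below-suc i i<1+N with m≤n⇒m<n∨m≡n (s≤s⁻¹ i<1+N)
  ... | inj₁ i<N = below i i<N
  ... | inj₂ refl = fN

ConvexTriangle : Bool → Bool → Bool → Set
ConvexTriangle a c e = b2n a + b2n c + b2n e ≤ 1 ⊎ (a ≡ true × c ≡ true × e ≡ true)

count≤1-¬₂₃ : ∀ a {c e} → c ≡ false → e ≡ false → b2n a + b2n c + b2n e ≤ 1
count≤1-¬₂₃ true refl refl = ≤-refl
count≤1-¬₂₃ false refl refl = z≤n

count≤1-¬₁₂ : ∀ {a c} e → a ≡ false → c ≡ false → b2n a + b2n c + b2n e ≤ 1
count≤1-¬₁₂ true refl refl = ≤-refl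
count≤1-¬₁₂ false refl refl = z≤n

count≤1-¬₁₃ : ∀ {a} c {e} → a ≡ false → e ≡ false → b2n a + b2n c + b2n e ≤ 1
count≤1-¬₁₃ true refl refl = ≤-refl
count≤1-¬₁₃ false refl refl = z≤n

triangle-closed₁ : ∀ {a c e} → c ≡ true → e ≡ true → ConvexTriangle a c e → a ≡ true
triangle-closed₁ {true} _ _ _ = refl
triangle-closed₁ {false} refl refl (inj₁ (s≤s ()))

triangle-closed₂ : ∀ {a c e} → a ≡ true → e ≡ true → ConvexTriangle a c e → c ≡ true
triangle-closed₂ {c = true} _ _ _ = refl
triangle-closed₂ {c = false} refl refl (inj₁ (s≤s ()))

triangle-closed₃ : ∀ {a c e} → a ≡ true → c ≡ true → ConvexTriangle a c e → e ≡ true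
triangle-closed₃ {e = true} _ _ _ = refl
triangle-closed₃ {e = false} refl refl (inj₁ (s≤s ()))

true≢false : ∀ {b} → b ≡ true → b ≡ false → ⊥
true≢false refl ()

⊆ᴱ-antisym : ∀ {n} {G G' : Subgraph n} → G ⊆ᴱ G' → G' ⊆ᴱ G → ∀ x → G x ≡ G' x
⊆ᴱ-antisym {G = G} {G'} G⊆G' G'⊆G x with G x in Gx | G' x in G'x
... | true | true = refl
... | false | false = refl
... | true | false = ⊥-elim (true≢false (G⊆G' x Gx) G'x)
... | false | true = ⊥-elim (true≢false (G'⊆G x G'x) Gx)

ℤ+-cancelˡ : ∀ a {b c} → a +ℤ b ≡ a +ℤ c → b ≡ c
ℤ+-cancelˡ a {b} {c} e = begin
  b                    ≡⟨ -a+[a+b]≡b a b ⟩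
  - a +ℤ (a +ℤ b)  ≡⟨ cong (- a +ℤ_) e ⟩
  - a +ℤ (a +ℤ c)  ≡⟨ sym (-a+[a+b]≡b a c) ⟩
  c                    ∎
  where
  open ≡-Reasoning
  -a+[a+b]≡b : ∀ a b → b ≡ - a +ℤ (a +ℤ b)
  -a+[a+b]≡b = ℤ-solve-∀

-- The square cycle: edges, walks and their lifts

module Square (n : ℕ) {{_ : NonZero n}} (n≥5 : 5 ≤ n) where
  open ZMod n

  frame-injective : ∀ {u v : Fin n} → frame u ≡ frame v → u ≡ v
  frame-injective refl = refl

  window-injective : ∀ {u v : Fin n} → window u ≡ window v → u ≡ v
  window-injective refl = refl

  len : Edge n → ℕ
  len (frame _) = 1
  len (window _) = 2

  tgt≡src+ᵥlen : ∀ x → tgt x ≡ src x +ᵥ len x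
  tgt≡src+ᵥlen (frame _) = refl
  tgt≡src+ᵥlen (window _) = refl

  0<len : ∀ x → 0 < len x
  0<len (frame _) = s≤s z≤n
  0<len (window _) = s≤s z≤n

  len≤2 : ∀ x → len x ≤ 2
  len≤2 (frame _) = s≤s z≤n
  len≤2 (window _) = s≤s (s≤s z≤n)

  <n : ∀ {k} → k ≤ 4 → k < n
  <n k≤4 = ≤-trans (s≤s k≤4) n≥5

  0<n : 0 < n
  0<n = <n z≤n

  1<n : 1 < n
  1<n = <n (s≤s z≤n)

  2<n : 2 < n
  2<n = <n (s≤s (s≤s z≤n))

  src≢tgt : ∀ x → src x ≢ tgt x
  src≢tgt x e = +ᵥ-≢ (src x) (0<len x) (<n (≤-trans (len≤2 x) (s≤s (s≤s z≤n))))
    (trans (sym (tgt≡src+ᵥlen x)) (sym e))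

  ¬antiparallel : ∀ x y → src y ≡ tgt x → tgt y ≡ src x → ⊥
  ¬antiparallel x y src≡ tgt≡ =
    +ᵥ-≢ (src x) (≤-trans (0<len x) (m≤m+n _ _)) (<n (+-mono-≤ (len≤2 x) (len≤2 y))) (begin
      src x +ᵥ (len x + len y)    ≡⟨ sym (+ᵥ-assoc (src x) (len x) (len y)) ⟩
      (src x +ᵥ len x) +ᵥ len y   ≡⟨ cong (_+ᵥ len y) (sym (tgt≡src+ᵥlen x)) ⟩
      tgt x +ᵥ len y              ≡⟨ cong (_+ᵥ len y) (sym src≡) ⟩
      src y +ᵥ len y              ≡⟨ sym (tgt≡src+ᵥlen y) ⟩
      tgt y                       ≡⟨ tgt≡ ⟩
      src x                       ∎)
    where open ≡-Reasoning

  parallel⇒len≡ : ∀ x y → src x ≡ src y → tgt x ≡ tgt y → len x ≡ len y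
  parallel⇒len≡ (frame _) (frame _) _ _ = refl
  parallel⇒len≡ (window _) (window _) _ _ = refl
  parallel⇒len≡ (frame i) (window j) src≡ tgt≡ = ⊥-elim (⟦⟧≢⟦+⟧ (toℕ i + 1) (s≤s z≤n) (<n (s≤s z≤n))
    (trans tgt≡ (trans (cong (_+ᵥ 2) (sym src≡)) (cong ⟦_⟧ (sym (+-assoc (toℕ i) 1 1))))))
  parallel⇒len≡ (window i) (frame j) src≡ tgt≡ = ⊥-elim (⟦⟧≢⟦+⟧ (toℕ j + 1) (s≤s z≤n) (<n (s≤s z≤n))
    (trans (sym tgt≡) (trans (cong (_+ᵥ 2) src≡) (cong ⟦_⟧ (sym (+-assoc (toℕ j) 1 1))))))

  open import Data.List.Membership.DecPropositional (FP._≟_ {n}) using (_∈?_)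

  SubgraphOfS : ℕ → Fin n → Subgraph n → Set
  SubgraphOfS k j G = ∀ x → G x ≡ true → InS k j x

  module Positions (G : Subgraph n) where

    E F : ℕ → Bool
    E p = G (frame ⟦ p ⟧)
    F p = G (window ⟦ p ⟧)

    E-toℕ : ∀ v → G (frame v) ≡ E (toℕ v)
    E-toℕ v = cong (λ w → G (frame w)) (sym (⟦toℕ⟧ v))

    F-toℕ : ∀ v → G (window v) ≡ F (toℕ v)
    F-toℕ v = cong (λ w → G (window w)) (sym (⟦toℕ⟧ v))

    E-+n : ∀ p → E (p + n) ≡ E p
    E-+n p = cong (λ w → G (frame w)) (⟦p+n⟧ p)

    F-+n : ∀ p → F (p + n) ≡ F p
    F-+n p = cong (λ w → G (window w)) (⟦p+n⟧ p)

    E-around : ∀ {a} m → a < n → E (a + (n ∸ a + m)) ≡ E m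
    E-around {a} m a<n = trans (cong E (trans (sym (+-assoc a (n ∸ a) m))
      (trans (cong (_+ m) (m+[n∸m]≡n (<⇒≤ a<n))) (+-comm n m)))) (E-+n m)

    E-% : ∀ p → E p ≡ E (p % n)
    E-% p = cong (λ w → G (frame w)) (%≡⇒⟦⟧≡ (sym (m%n%n≡m%n p n)))

    F-% : ∀ p → F p ≡ F (p % n)
    F-% p = cong (λ w → G (window w)) (%≡⇒⟦⟧≡ (sym (m%n%n≡m%n p n)))

    E-periodic : ∀ {b} → (∀ i → i < n → E i ≡ b) → ∀ p → E p ≡ b
    E-periodic all p = trans (E-% p) (all (p % n) (m%n<n p n))

    F-periodic : ∀ {b} → (∀ i → i < n → F i ≡ b) → ∀ p → F p ≡ b
    F-periodic all p = trans (F-% p) (all (p % n) (m%n<n p n))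

    Convex-at : ℕ → Set
    Convex-at p = ConvexTriangle (E p) (E (suc p)) (F p)

    convex⇒Convex-at : Convex G → ∀ p → Convex-at p
    convex⇒Convex-at convex p = subst (λ e → ConvexTriangle (E p) e (F p)) (cong (λ v → G (frame v)) (⟦⟧+ᵥ1 p)) (convex ⟦ p ⟧)

    Convex-from : ∀ a → (∀ {o} → o < n → Convex-at (a + o)) → Convex G
    Convex-from a convex-at v = subst (λ v → ConvexTriangle (G (frame v)) (G (frame (v +ᵥ 1))) (G (window v))) (⟦p+offset⟧ a v)
      (subst (λ e → ConvexTriangle (E p) e (F p)) (cong (λ v → G (frame v)) (sym (⟦⟧+ᵥ1 p))) (convex-at (offset<n ⟦ a ⟧ v)))
      where
      p : ℕ
      p = a + offset ⟦ a ⟧ v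

    frame-end-between : ∀ {a} c → E a ≡ true → E (a + c) ≡ false →
      Σ ℕ λ i → i < c × E (a + i) ≡ true × E (suc (a + i)) ≡ false
    frame-end-between {a} zero Ea Ea+0 = ⊥-elim (true≢false (trans (cong E (+-identityʳ a)) Ea) Ea+0)
    frame-end-between {a} (suc c) Ea Ea+1+c with E (a + c) in Ea+c
    ... | true = c , ≤-refl , Ea+c , trans (cong E (sym (+-suc a c))) Ea+1+c
    ... | false = let i , i<c , end = frame-end-between c Ea Ea+c in i , m≤n⇒m≤1+n i<c , end

    Gap : ℕ → ℕ → Set
    Gap d p = F p ≡ false × F (p + d) ≡ false × (∀ t → 1 ≤ t → t ≤ d → E (p + t) ≡ false)

    Gap⇒SubgraphOfS : ∀ {k p} → Gap (gap k) p → SubgraphOfS k ⟦ p ⟧ G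
    Gap⇒SubgraphOfS {k} {p} (Fp , Fp+d , E-run) x Gx =
      (λ { refl → true≢false Gx Fp }) ,
      (λ { refl → true≢false Gx (trans (cong (λ w → G (window w)) (⟦⟧+ᵥ p (gap k))) Fp+d) }) ,
      (λ { t 1≤t t≤d refl → true≢false Gx (trans (cong (λ w → G (frame w)) (⟦⟧+ᵥ p t)) (E-run t 1≤t t≤d)) })

  module Walks (G : Subgraph n) where
    open Positions G

    Walk : Fin n → Fin n → Set
    Walk = Star (Adj G)

    disp₁ : ∀ {u v} → Adj G u v → ℤ
    disp₁ (x , _ , inj₁ _) = ℤ.+ len x
    disp₁ (x , _ , inj₂ _) = - ℤ.+ len x

    disp : ∀ {u v} → Walk u v → ℤ
    disp ε = ℤ.+ 0
    disp (s ◅ w) = disp₁ s +ℤ disp w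

    disp-◅◅ : ∀ {u v t} (w : Walk u v) (w' : Walk v t) → disp (w ◅◅ w') ≡ disp w +ℤ disp w'
    disp-◅◅ ε w' = sym (ℤₚ.+-identityˡ _)
    disp-◅◅ (s ◅ w) w' = trans (cong (disp₁ s +ℤ_) (disp-◅◅ w w')) (sym (ℤₚ.+-assoc (disp₁ s) (disp w) (disp w')))

    disp-subst : ∀ {u v v'} (e : v ≡ v') (w : Walk u v) → disp (subst (Walk u) e w) ≡ disp w
    disp-subst refl w = refl

    ¬loop : ∀ {u} → ¬ Adj G u u
    ¬loop (x , _ , inj₁ (refl , e)) = src≢tgt x (sym e)
    ¬loop (x , _ , inj₂ (e , refl)) = src≢tgt x e

    disp-backtrack : ∀ {u v} (s : Adj G u v) (s' : Adj G v u) → disp₁ s +ℤ disp₁ s' ≡ ℤ.+ 0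
    disp-backtrack (x , _ , inj₁ (refl , refl)) (y , _ , inj₁ (e , e')) = ⊥-elim (¬antiparallel x y e e')
    disp-backtrack (x , _ , inj₂ (refl , refl)) (y , _ , inj₂ (e , e')) = ⊥-elim (¬antiparallel x y e e')
    disp-backtrack (x , _ , inj₁ (refl , refl)) (y , _ , inj₂ (e , e')) =
      trans (cong (λ l → ℤ.+ len x +ℤ - ℤ.+ l) (sym (parallel⇒len≡ x y (sym e) (sym e')))) (ℤₚ.+-inverseʳ (ℤ.+ len x))
    disp-backtrack (x , _ , inj₂ (refl , refl)) (y , _ , inj₁ (e , e')) =
      trans (cong (λ l → - ℤ.+ len x +ℤ ℤ.+ l) (sym (parallel⇒len≡ x y (sym e) (sym e')))) (ℤₚ.+-inverseˡ (ℤ.+ len x))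

    vertices : ∀ {u v} → Walk u v → List (Fin n)
    vertices {u} ε = u ∷ []
    vertices {u} (s ◅ w) = u ∷ vertices w

    Simple : ∀ {u v} → Walk u v → Set
    Simple ε = ⊤
    Simple {u} (s ◅ w) = u ∉ vertices w × Simple w

    steps : ∀ {u v} → Walk u v → ℕ
    steps ε = 0
    steps (s ◅ w) = suc (steps w)

    vertex-at : ∀ {u v} → Walk u v → ℕ → Fin n
    vertex-at {u} ε _ = u
    vertex-at {u} (s ◅ w) zero = u
    vertex-at (s ◅ w) (suc i) = vertex-at w i

    vertex-at-0 : ∀ {u v} (w : Walk u v) → vertex-at w 0 ≡ u
    vertex-at-0 ε = refl
    vertex-at-0 (s ◅ w) = refl

    vertex-at-end : ∀ {u v} (w : Walk u v) → vertex-at w (steps w) ≡ v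
    vertex-at-end ε = refl
    vertex-at-end (s ◅ w) = vertex-at-end w

    vertex-at-∈ : ∀ {u v} (w : Walk u v) {i} → i ≤ steps w → vertex-at w i ∈ vertices w
    vertex-at-∈ ε {zero} _ = here refl
    vertex-at-∈ (s ◅ w) {zero} _ = here refl
    vertex-at-∈ (s ◅ w) {suc i} (s≤s i≤) = there (vertex-at-∈ w i≤)

    end-∈ : ∀ {u v} (w : Walk u v) → v ∈ vertices w
    end-∈ w = subst (_∈ vertices w) (vertex-at-end w) (vertex-at-∈ w ≤-refl)

    vertex-at-adj : ∀ {u v} (w : Walk u v) {i} → i < steps w → Adj G (vertex-at w i) (vertex-at w (suc i))
    vertex-at-adj (s ◅ w) {zero} _ = subst (Adj G _) (sym (vertex-at-0 w)) s
    vertex-at-adj (s ◅ w) {suc i} (s≤s i<) = vertex-at-adj w i<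

    vertex-at-injective : ∀ {u v} (w : Walk u v) → Simple w → ∀ {i j} → i ≤ steps w → j ≤ steps w →
      vertex-at w i ≡ vertex-at w j → i ≡ j
    vertex-at-injective ε _ {zero} {zero} _ _ _ = refl
    vertex-at-injective (s ◅ w) _ {zero} {zero} _ _ _ = refl
    vertex-at-injective (s ◅ w) (u∉ , _) {zero} {suc j} _ (s≤s j≤) e = ⊥-elim (u∉ (subst (_∈ vertices w) (sym e) (vertex-at-∈ w j≤)))
    vertex-at-injective (s ◅ w) (u∉ , _) {suc i} {zero} (s≤s i≤) _ e = ⊥-elim (u∉ (subst (_∈ vertices w) e (vertex-at-∈ w i≤)))
    vertex-at-injective (s ◅ w) (_ , simple) {suc i} {suc j} (s≤s i≤) (s≤s j≤) e = cong suc (vertex-at-injective w simple i≤ j≤ e)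

    simple-cycle : ∀ {u v} (s : Adj G u v) (w : Walk v u) → Simple w → 2 ≤ steps w → HasCycle G
    simple-cycle {u} {v} s w simple 2≤ = m , c , c-injective , c-adj
      where
      m : ℕ
      m = steps w ∸ 2
      3+m≡ : 3 + m ≡ suc (steps w)
      3+m≡ = cong suc (trans (+-comm 2 m) (m∸n+n≡m 2≤))
      c : Fin (3 + m) → Fin n
      c i = vertex-at w (toℕ i)
      i≤ : ∀ (i : Fin (3 + m)) → toℕ i ≤ steps w
      i≤ i = s≤s⁻¹ (subst (toℕ i <_) 3+m≡ (FP.toℕ<n i))
      c-injective : ∀ {i j} → c i ≡ c j → i ≡ j
      c-injective {i} {j} e = FP.toℕ-injective (vertex-at-injective w simple (i≤ i) (i≤ j) e)
      toℕ-suc : ∀ (i : Fin (3 + m)) → toℕ (i +ᵥ 1) ≡ (suc (toℕ i)) % (3 + m)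
      toℕ-suc i = trans (FP.toℕ-fromℕ< _) (cong (_% (3 + m)) (+-comm (toℕ i) 1))
      c-adj : ∀ (i : Fin (3 + m)) → Adj G (c i) (c (i +ᵥ 1))
      c-adj i with toℕ i <? steps w
      ... | yes i<steps = subst (Adj G (c i)) (cong (vertex-at w) (sym i+1≡)) (vertex-at-adj w i<steps)
        where
        i+1≡ : toℕ (i +ᵥ 1) ≡ suc (toℕ i)
        i+1≡ = trans (toℕ-suc i) (m<n⇒m%n≡m (subst (suc (toℕ i) <_) (sym 3+m≡) (s≤s i<steps)))
      ... | no i≮steps = subst₂ (Adj G) (sym ci≡u) (sym ci+1≡v) s
        where
        i≡ : toℕ i ≡ steps w
        i≡ = ≤-antisym (i≤ i) (≮⇒≥ i≮steps)
        ci≡u : c i ≡ u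
        ci≡u = trans (cong (vertex-at w) i≡) (vertex-at-end w)
        ci+1≡v : c (i +ᵥ 1) ≡ v
        ci+1≡v = trans (cong (vertex-at w) (trans (toℕ-suc i)
          (trans (cong (λ k → suc k % (3 + m)) i≡) (trans (cong (_% (3 + m)) (sym 3+m≡)) (n%n≡0 (3 + m))))))
          (vertex-at-0 w)

    split-at : ∀ {v t u} (p : Walk v t) → u ∈ vertices p →
      Σ (Walk v u) λ p₁ → Σ (Walk u t) λ p₂ →
        (Simple p → Simple p₁ × Simple p₂) × disp p ≡ disp p₁ +ℤ disp p₂ ×
        (∀ {z} → z ∈ vertices p₁ → z ∈ vertices p)
    split-at ε (here refl) = ε , ε , (λ _ → tt , tt) , refl , (λ z → z)
    split-at (s ◅ p) (here refl) = ε , s ◅ p , (λ simple → tt , simple) , sym (ℤₚ.+-identityˡ _) ,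
      λ { (here e) → here e ; (there ()) }
    split-at (s ◅ p) (there u∈) with split-at p u∈
    ... | p₁ , p₂ , simple , disp≡ , ⊆p = s ◅ p₁ , p₂ ,
          (λ { (v∉ , sp) → ((λ z → v∉ (⊆p z)) , proj₁ (simple sp)) , proj₂ (simple sp) }) ,
          trans (cong (disp₁ s +ℤ_) disp≡) (sym (ℤₚ.+-assoc (disp₁ s) (disp p₁) (disp p₂))) ,
          λ { (here e) → here e ; (there z) → there (⊆p z) }

    module _ (acyclic : Acyclic G) where

      -- A simple walk from v back to u, right after the step u → v, either retraces that step
      -- or closes a cycle.
      prepend-simple : ∀ {u v t} (s : Adj G u v) (p : Walk v t) → Simple p →
        Σ (Walk u t) λ q → Simple q × disp q ≡ disp₁ s +ℤ disp p
      prepend-simple {u} s p simple with u ∈? vertices p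
      ... | no u∉ = s ◅ p , (u∉ , simple) , refl
      ... | yes u∈ with split-at p u∈
      ...   | p₁ , p₂ , split-simple , disp≡ , _ =
              let q , simple-q , disp-q = retrace s p₁ p₂ (proj₁ (split-simple simple)) (proj₂ (split-simple simple))
              in q , simple-q , trans disp-q (cong (disp₁ s +ℤ_) (sym disp≡))
        where
        retrace : ∀ {u v t} (s : Adj G u v) (p₁ : Walk v u) (p₂ : Walk u t) → Simple p₁ → Simple p₂ →
          Σ (Walk u t) λ q → Simple q × disp q ≡ disp₁ s +ℤ (disp p₁ +ℤ disp p₂)
        retrace s ε p₂ _ _ = ⊥-elim (¬loop s)
        retrace s (s' ◅ ε) p₂ _ simple₂ = p₂ , simple₂ , (begin
          disp p₂                                       ≡⟨ sym (ℤₚ.+-identityˡ (disp p₂)) ⟩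
          ℤ.+ 0 +ℤ disp p₂                              ≡⟨ cong (_+ℤ disp p₂) (sym (disp-backtrack s s')) ⟩
          (disp₁ s +ℤ disp₁ s') +ℤ disp p₂              ≡⟨ assoc (disp₁ s) (disp₁ s') (disp p₂) ⟩
          disp₁ s +ℤ ((disp₁ s' +ℤ ℤ.+ 0) +ℤ disp p₂)   ∎)
          where
          open ≡-Reasoning
          assoc : ∀ a b c → (a +ℤ b) +ℤ c ≡ a +ℤ ((b +ℤ ℤ.+ 0) +ℤ c)
          assoc = ℤ-solve-∀
        retrace s (s' ◅ s'' ◅ p₁) p₂ simple₁ _ = ⊥-elim (acyclic (simple-cycle s (s' ◅ s'' ◅ p₁) simple₁ (s≤s (s≤s z≤n))))

      simplify : ∀ {u v} (w : Walk u v) → Σ (Walk u v) λ p → Simple p × disp p ≡ disp w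
      simplify ε = ε , tt , refl
      simplify (s ◅ w) with simplify w
      ... | p , simple , disp-p with prepend-simple s p simple
      ...   | q , simple-q , disp-q = q , simple-q , trans disp-q (cong (disp₁ s +ℤ_) disp-p)

      closed-walk-disp≡0 : ∀ {u} (w : Walk u u) → disp w ≡ ℤ.+ 0
      closed-walk-disp≡0 w with simplify w
      ... | ε , _ , disp-p = sym disp-p
      ... | s ◅ p , (u∉ , _) , _ = ⊥-elim (u∉ (end-∈ p))

    Reach : ℕ → ℕ → Set
    Reach p q = Σ (Walk ⟦ p ⟧ ⟦ q ⟧) λ w → disp w +ℤ ℤ.+ p ≡ ℤ.+ q

    Reach-refl : ∀ {p} → Reach p p
    Reach-refl = ε , refl

    Reach-trans : ∀ {p q r} → Reach p q → Reach q r → Reach p r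
    Reach-trans {p} {q} {r} (w , disp-w) (w' , disp-w') = w ◅◅ w' , (begin
      disp (w ◅◅ w') +ℤ ℤ.+ p         ≡⟨ cong (_+ℤ ℤ.+ p) (disp-◅◅ w w') ⟩
      (disp w +ℤ disp w') +ℤ ℤ.+ p    ≡⟨ swap (disp w) (disp w') (ℤ.+ p) ⟩
      disp w' +ℤ (disp w +ℤ ℤ.+ p)    ≡⟨ cong (disp w' +ℤ_) disp-w ⟩
      disp w' +ℤ ℤ.+ q                ≡⟨ disp-w' ⟩
      ℤ.+ r                           ∎)
      where
      open ≡-Reasoning
      swap : ∀ a b c → (a +ℤ b) +ℤ c ≡ b +ℤ (a +ℤ c)
      swap = ℤ-solve-∀

    Reach-≡ : ∀ {p q q'} → q ≡ q' → Reach p q → Reach p q'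
    Reach-≡ refl r = r

    tgt≡⟦+len⟧ : ∀ {p} x → src x ≡ ⟦ p ⟧ → tgt x ≡ ⟦ p + len x ⟧
    tgt≡⟦+len⟧ {p} x e = trans (tgt≡src+ᵥlen x) (trans (cong (_+ᵥ len x) e) (⟦⟧+ᵥ p (len x)))

    step : ∀ {p} x → G x ≡ true → src x ≡ ⟦ p ⟧ → Reach p (p + len x)
    step {p} x Gx e = (x , Gx , inj₁ (e , tgt≡⟦+len⟧ x e)) ◅ ε ,
      trans (cong (_+ℤ ℤ.+ p) (ℤₚ.+-identityʳ (ℤ.+ len x))) (trans (sym (ℤₚ.pos-+ (len x) p)) (cong ℤ.+_ (+-comm (len x) p)))

    step⁻¹ : ∀ {p} x → G x ≡ true → src x ≡ ⟦ p ⟧ → Reach (p + len x) p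
    step⁻¹ {p} x Gx e = (x , Gx , inj₂ (e , tgt≡⟦+len⟧ x e)) ◅ ε ,
      trans (cong (λ z → (- ℤ.+ len x +ℤ ℤ.+ 0) +ℤ z) (trans (cong ℤ.+_ (+-comm p (len x))) (ℤₚ.pos-+ (len x) p)))
            (cancel (ℤ.+ len x) (ℤ.+ p))
      where
      cancel : ∀ a b → (- a +ℤ ℤ.+ 0) +ℤ (a +ℤ b) ≡ b
      cancel = ℤ-solve-∀

    frame-step : ∀ {a q} → Reach a q → E q ≡ true → Reach a (suc q)
    frame-step {q = q} r Eq = Reach-trans r (Reach-≡ (+-comm q 1) (step (frame ⟦ q ⟧) Eq refl))

    frame-step⁻¹ : ∀ {a q} → Reach a (suc q) → E q ≡ true → Reach a q
    frame-step⁻¹ {q = q} r Eq = Reach-trans r (subst (λ z → Reach z q) (+-comm q 1) (step⁻¹ (frame ⟦ q ⟧) Eq refl))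

    window-step : ∀ {a q} → Reach a q → F q ≡ true → Reach a (2 + q)
    window-step {q = q} r Fq = Reach-trans r (Reach-≡ (+-comm q 2) (step (window ⟦ q ⟧) Fq refl))

    frame-steps : ∀ p c → (∀ i → i < c → E (p + i) ≡ true) → Reach p (p + c)
    frame-steps p zero _ = Reach-≡ (sym (+-identityʳ p)) Reach-refl
    frame-steps p (suc c) E-all = Reach-≡ (sym (+-suc p c))
      (frame-step (frame-steps p c (λ i i<c → E-all i (m≤n⇒m≤1+n i<c))) (E-all c ≤-refl))

    window-steps : ∀ p c → (∀ i → i < c → F (p + 2 * i) ≡ true) → Reach p (p + 2 * c)
    window-steps p zero _ = Reach-≡ (sym (+-identityʳ p)) Reach-refl
    window-steps p (suc c) F-all = Reach-≡ (2+[p+2c]≡p+2[1+c] p c)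
      (window-step (window-steps p c (λ i i<c → F-all i (m≤n⇒m≤1+n i<c))) (F-all c ≤-refl))
      where
      2+[p+2c]≡p+2[1+c] : ∀ p c → 2 + (p + 2 * c) ≡ p + 2 * suc c
      2+[p+2c]≡p+2[1+c] = solve-∀

    ¬Reach-around : Acyclic G → ∀ p c → 0 < c → ¬ Reach p (p + c * n)
    ¬Reach-around acyclic p c 0<c (w , disp-w) = <⇒≢ (*-mono-< 0<c (≤-trans (s≤s z≤n) n≥5))
      (sym (+-cancelˡ-≡ p (c * n) 0 (trans (sym (ℤₚ.+-injective p≡)) (sym (+-identityʳ p)))))
      where
      wraps : ⟦ p + c * n ⟧ ≡ ⟦ p ⟧
      wraps = %≡⇒⟦⟧≡ ([m+kn]%n≡m%n p c n)
      disp≡0 : disp w ≡ ℤ.+ 0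
      disp≡0 = trans (sym (disp-subst wraps w)) (closed-walk-disp≡0 acyclic (subst (Walk ⟦ p ⟧) wraps w))
      p≡ : ℤ.+ (0 + p) ≡ ℤ.+ (p + c * n)
      p≡ = trans (sym (cong (_+ℤ ℤ.+ p) disp≡0)) disp-w

  -- Every spanning tree lies in some S_{n,k,j}

  module Existence (G : Subgraph n) (acyclic : Acyclic G) where
    open Positions G
    open Walks G

    HasGap : Set
    HasGap = Σ ℕ λ k → gap k ≤ n × Σ ℕ λ p → Gap (gap k) p

    MissingRun : ℕ → ℕ → ℕ → Set
    MissingRun a j q = F j ≡ false × a ≤ j × (∀ t → j < t → t ≤ q → E t ≡ false)

    -- Sweeping q upwards from a: normally both q and q + 1 are reached from a; inside a run of
    -- missing frames that follows the missing window f_j, only the positions at odd distance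
    -- from j are reached, through windows.
    Invariant : ℕ → ℕ → Set
    Invariant a q = (Reach a q × Reach a (suc q))
      ⊎ (Reach a q × Σ ℕ λ j → Σ ℕ λ k → q ≡ j + gap k × MissingRun a j q)
      ⊎ (Reach a (suc q) × Σ ℕ λ j → Σ ℕ λ k → q ≡ j + 2 * k × MissingRun a j q)

    MissingRun-extend : ∀ {a j q} → MissingRun a j q → E (suc q) ≡ false → MissingRun a j (suc q)
    MissingRun-extend {j = j} {q} (Fj , a≤j , run) E-suc-q = Fj , a≤j , extended
      where
      extended : ∀ t → j < t → t ≤ suc q → E t ≡ false
      extended t j<t t≤1+q with m≤n⇒m<n∨m≡n t≤1+q
      ... | inj₁ t<1+q = run t j<t (s≤s⁻¹ t<1+q)
      ... | inj₂ refl = E-suc-q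

    MissingRun⇒HasGap : ∀ {a j q} k → MissingRun a j q → q ≡ j + gap k → q < a + n → F q ≡ false → HasGap
    MissingRun⇒HasGap {a} {j} {q} k (Fj , a≤j , run) refl q<a+n Fq = k , gap≤n , j , Fj , Fq ,
      λ t 1≤t t≤gap → run (j + t) (m<m+n j 1≤t) (+-monoʳ-≤ j t≤gap)
      where
      gap≤n : gap k ≤ n
      gap≤n = <⇒≤ (+-cancelˡ-< a (gap k) n (≤-<-trans (+-monoˡ-≤ (gap k) a≤j) q<a+n))

    sweep-step : ∀ {a q} → a ≤ q → q < a + n → Invariant a q → Invariant a (suc q) ⊎ HasGap
    sweep-step {a} {q} a≤q q<a+n inv with E (suc q) in E-suc-q | F q in Fq | inv
    ... | true | _ | inj₁ (_ , r₁) = inj₁ (inj₁ (r₁ , frame-step r₁ E-suc-q))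
    ... | true | _ | inj₂ (inj₂ (r₁ , _)) = inj₁ (inj₁ (r₁ , frame-step r₁ E-suc-q))
    ... | true | true | inj₂ (inj₁ (r₀ , _)) =
          let r₂ = window-step r₀ Fq in inj₁ (inj₁ (frame-step⁻¹ r₂ E-suc-q , r₂))
    ... | true | false | inj₂ (inj₁ (_ , j , k , q≡ , run)) = inj₂ (MissingRun⇒HasGap k run q≡ q<a+n Fq)
    ... | false | true | inj₁ (r₀ , r₁) = inj₁ (inj₁ (r₁ , window-step r₀ Fq))
    ... | false | true | inj₂ (inj₁ (r₀ , j , k , q≡ , run)) =
          inj₁ (inj₂ (inj₂ (window-step r₀ Fq , j , suc k , trans (cong suc q≡) (1+[j+gap]≡j+2[1+k] j k) , MissingRun-extend run E-suc-q)))
      where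
      1+[j+gap]≡j+2[1+k] : ∀ j k → suc (j + (2 * k + 1)) ≡ j + 2 * suc k
      1+[j+gap]≡j+2[1+k] = solve-∀
    ... | false | _ | inj₂ (inj₂ (r₁ , j , k , q≡ , run)) =
          inj₁ (inj₂ (inj₁ (r₁ , j , k , trans (cong suc q≡) (1+[j+2k]≡j+gap j k) , MissingRun-extend run E-suc-q)))
      where
      1+[j+2k]≡j+gap : ∀ j k → suc (j + 2 * k) ≡ j + (2 * k + 1)
      1+[j+2k]≡j+gap = solve-∀
    ... | false | false | inj₁ (_ , r₁) = inj₁ (inj₂ (inj₁ (r₁ , q , 0 , +-comm 1 q , (Fq , a≤q , missing))))
      where
      missing : ∀ t → q < t → t ≤ suc q → E t ≡ false
      missing t q<t t≤1+q = subst (λ z → E z ≡ false) (≤-antisym q<t t≤1+q) E-suc-q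
    ... | false | false | inj₂ (inj₁ (_ , j , k , q≡ , run)) = inj₂ (MissingRun⇒HasGap k run q≡ q<a+n Fq)

    sweep : ∀ {a} → E a ≡ true → ∀ i → i ≤ n → Invariant a (a + i) ⊎ HasGap
    sweep {a} Ea zero _ = inj₁ (inj₁ (Reach-≡ (sym (+-identityʳ a)) Reach-refl ,
                                     Reach-≡ (cong suc (sym (+-identityʳ a))) (frame-step Reach-refl Ea)))
    sweep {a} Ea (suc i) 1+i≤n with sweep Ea i (<⇒≤ 1+i≤n)
    ... | inj₂ has-gap = inj₂ has-gap
    ... | inj₁ inv with sweep-step (m≤m+n a i) (+-monoʳ-< a 1+i≤n) inv
    ...   | inj₂ has-gap = inj₂ has-gap
    ...   | inj₁ inv' = inj₁ (subst (Invariant a) (sym (+-suc a i)) inv')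

    gap-with-frame : ∀ {a} → E a ≡ true → HasGap
    gap-with-frame {a} Ea with sweep Ea n ≤-refl
    ... | inj₂ has-gap = has-gap
    ... | inj₁ inv = ⊥-elim (¬Reach-around acyclic a 1 (s≤s z≤n) (Reach-≡ (cong (a +_) (sym (*-identityˡ n))) (around inv)))
      where
      around : Invariant a (a + n) → Reach a (a + n)
      around (inj₁ (r , _)) = r
      around (inj₂ (inj₁ (r , _))) = r
      around (inj₂ (inj₂ (r , _))) = frame-step⁻¹ r (trans (E-+n a) Ea)

    window-class-broken : ∀ {h} → n ≡ 2 * h → ∀ p → ¬ (∀ i → i < h → F (p + 2 * i) ≡ true)
    window-class-broken {h} n≡2h p all = ¬Reach-around acyclic p 1 (s≤s z≤n)
      (Reach-≡ (cong (p +_) (trans (sym n≡2h) (sym (*-identityˡ n)))) (window-steps p h all))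

    frameless-gap : (∀ p → E p ≡ false) → ∀ {p} r → gap r ≤ n → F p ≡ false → F (p + gap r) ≡ false → HasGap
    frameless-gap no-frames {p} r gap≤n Fp Fp+gap = r , gap≤n , p , Fp , Fp+gap , λ t _ _ → no-frames (p + t)

    gap-between-classes : (∀ p → E p ≡ false) → ∀ {h} → n ≡ 2 * h → ∀ {e o} → e < h → o < h →
      F (2 * e) ≡ false → F (1 + 2 * o) ≡ false → HasGap
    gap-between-classes no-frames {h} n≡ {e} {o} e<h o<h Fe Fo with e ≤? o
    ... | yes e≤o = frameless-gap no-frames (o ∸ e) (<⇒≤ (subst (_ <_) (sym n≡) (gap<2* (≤-<-trans (m∸n≤m o e) o<h)))) Fe
          (subst (λ p → F p ≡ false) (trans (cong (λ o → 1 + 2 * o) (sym (m+[n∸m]≡n e≤o))) (even-to-odd e (o ∸ e))) Fo)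
      where
      even-to-odd : ∀ e r → 1 + 2 * (e + r) ≡ 2 * e + (2 * r + 1)
      even-to-odd = solve-∀
    ... | no e≰o = frameless-gap no-frames (e ∸ suc o) (<⇒≤ (subst (_ <_) (sym n≡) (gap<2* (≤-<-trans (m∸n≤m e (suc o)) e<h)))) Fo
          (subst (λ p → F p ≡ false) (trans (cong (2 *_) (sym (m+[n∸m]≡n (≰⇒> e≰o)))) (odd-to-even o (e ∸ suc o))) Fe)
      where
      odd-to-even : ∀ o r → 2 * (suc o + r) ≡ 1 + 2 * o + (2 * r + 1)
      odd-to-even = solve-∀

    gap-without-frames-even : (∀ p → E p ≡ false) → ∀ {h} → n ≡ 2 * h → HasGap
    gap-without-frames-even no-frames {h} n≡ with least-false (λ i → F (2 * i)) h | least-false (λ i → F (1 + 2 * i)) h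
    ... | inj₁ evens | _ = ⊥-elim (window-class-broken n≡ 0 evens)
    ... | inj₂ _ | inj₁ odds = ⊥-elim (window-class-broken n≡ 1 odds)
    ... | inj₂ (e , e<h , Fe , _) | inj₂ (o , o<h , Fo , _) = gap-between-classes no-frames n≡ e<h o<h Fe Fo

    gap-without-frames : (∀ p → E p ≡ false) → HasGap
    gap-without-frames no-frames with least-false F n | even-or-odd n
    ... | inj₁ all | _ = ⊥-elim (¬Reach-around acyclic 0 2 (s≤s z≤n) (window-steps 0 n (λ i _ → F-periodic all (2 * i))))
    ... | inj₂ (j , _ , Fj , _) | inj₂ (h , n≡) =
          frameless-gap no-frames h (≤-reflexive (sym n≡)) Fj (trans (cong (λ d → F (j + d)) (sym n≡)) (trans (F-+n j) Fj))
    ... | inj₂ _ | inj₁ (h , n≡) = gap-without-frames-even no-frames {h} n≡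

    has-gap : HasGap
    has-gap with least-false (λ p → not (E p)) n
    ... | inj₂ (a , _ , ¬Ea , _) = gap-with-frame (not-injective ¬Ea)
    ... | inj₁ none = gap-without-frames (E-periodic (λ i i<n → not-injective (none i i<n)))

  -- Potentials, and uniqueness of (k, j)

  Consistent : (Fin n → ℕ) → Edge n → Set
  Consistent φ x = φ (tgt x) ≡ φ (src x) + len x

  +*n-cancelˡ : ∀ a {A B} → a + A * n ≡ a + B * n → A ≡ B
  +*n-cancelˡ a {A} {B} e = *-cancelʳ-≡ A B n (+-cancelˡ-≡ a (A * n) (B * n) e)

  -- The potential lifting S_{n,k,j} to the integers: a vertex at offset o from j is lifted
  -- to o + level o * n, where level o counts the windings of the lift up to that vertex.
  module Potential (k : ℕ) (j : Fin n) (gap≤n : gap k ≤ n) where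
    d b : ℕ
    d = gap k
    b = toℕ j

    level : ℕ → ℕ
    level o with o ≟ 0 | d ≟ n | even? o | o ≤? d
    ... | yes _ | yes _ | _ | _ = 2
    ... | yes _ | no _ | _ | _ = 1
    ... | no _ | _ | no _ | yes _ = 1
    ... | no _ | _ | _ | _ = 0

    level-0-< : d < n → level 0 ≡ 1
    level-0-< d<n with d ≟ n
    ... | yes d≡n = ⊥-elim (<⇒≢ d<n d≡n)
    ... | no _ = refl

    level-0-≡ : d ≡ n → level 0 ≡ 2
    level-0-≡ d≡n with d ≟ n
    ... | yes _ = refl
    ... | no d≢n = ⊥-elim (d≢n d≡n)

    level-odd : ∀ {o} → 0 < o → Odd o → o ≤ d → level o ≡ 1
    level-odd {o} 0<o odd o≤d with o ≟ 0 | d ≟ n | even? o | o ≤? d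
    ... | yes o≡0 | _ | _ | _ = ⊥-elim (<⇒≢ 0<o (sym o≡0))
    ... | no _ | _ | yes even | _ = ⊥-elim (even∧odd⇒⊥ even odd)
    ... | no _ | _ | no _ | yes _ = refl
    ... | no _ | _ | no _ | no o≰d = ⊥-elim (o≰d o≤d)

    level-even : ∀ {o} → 0 < o → Even o → level o ≡ 0
    level-even {o} 0<o even with o ≟ 0 | d ≟ n | even? o | o ≤? d
    ... | yes o≡0 | _ | _ | _ = ⊥-elim (<⇒≢ 0<o (sym o≡0))
    ... | no _ | _ | no ¬even | _ = ⊥-elim (¬even even)
    ... | no _ | _ | yes _ | _ = refl

    level-beyond : ∀ {o} → d < o → level o ≡ 0
    level-beyond {o} d<o with o ≟ 0 | d ≟ n | even? o | o ≤? d
    ... | yes refl | _ | _ | _ = ⊥-elim (<⇒≱ d<o z≤n)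
    ... | no _ | _ | no _ | yes o≤d = ⊥-elim (<⇒≱ d<o o≤d)
    ... | no _ | _ | yes _ | _ = refl
    ... | no _ | _ | no _ | no _ = refl

    level-1 : level 1 ≡ 1
    level-1 = level-odd (s≤s z≤n) (0 , refl) (1≤gap k)

    φ : Fin n → ℕ
    φ v = offset j v + level (offset j v) * n

    Rises : ℕ → ℕ → Set
    Rises o l = φ (⟦ b + o ⟧ +ᵥ l) ≡ φ ⟦ b + o ⟧ + l

    φ-⟦+⟧ : ∀ {o} → o < n → φ ⟦ b + o ⟧ ≡ o + level o * n
    φ-⟦+⟧ o<n = cong (λ o → o + level o * n) (offset-⟦+⟧ j o<n)

    rises-inside : ∀ {o l} → o < n → o + l < n → Rises o l ⇔ level (o + l) ≡ level o
    rises-inside {o} {l} o<n o+l<n = mk⇔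
      (λ rises → +*n-cancelˡ (o + l) (trans (sym φ-tgt) (trans rises (trans (cong (_+ l) (φ-⟦+⟧ o<n)) (swap o (level o * n) l)))))
      (λ level≡ → trans φ-tgt (trans (cong (λ L → o + l + L * n) level≡)
                   (trans (sym (swap o (level o * n) l)) (cong (_+ l) (sym (φ-⟦+⟧ o<n))))))
      where
      φ-tgt : φ (⟦ b + o ⟧ +ᵥ l) ≡ o + l + level (o + l) * n
      φ-tgt = cong (λ o → o + level o * n) (offset-+ᵥ j o+l<n)
      swap : ∀ a c l → a + c + l ≡ a + l + c
      swap = solve-∀

    rises-wrapping : ∀ {o l r} → o < n → o + l ≡ n + r → r < n → Rises o l ⇔ level r ≡ suc (level o)
    rises-wrapping {o} {l} {r} o<n o+l≡ r<n = mk⇔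
      (λ rises → +*n-cancelˡ r (trans (sym φ-tgt) (trans rises φ-src+l)))
      (λ level≡ → trans φ-tgt (trans (cong (λ L → r + L * n) level≡) (sym φ-src+l)))
      where
      φ-tgt : φ (⟦ b + o ⟧ +ᵥ l) ≡ r + level r * n
      φ-tgt = cong (λ o → o + level o * n) (offset-+ᵥ-wrap j o+l≡ r<n)
      φ-src+l : φ ⟦ b + o ⟧ + l ≡ r + suc (level o) * n
      φ-src+l = begin
        φ ⟦ b + o ⟧ + l           ≡⟨ cong (_+ l) (φ-⟦+⟧ o<n) ⟩
        o + level o * n + l       ≡⟨ swap o (level o * n) l ⟩
        o + l + level o * n       ≡⟨ cong (_+ level o * n) o+l≡ ⟩
        n + r + level o * n       ≡⟨ shuffle n r (level o * n) ⟩
        r + (n + level o * n)     ∎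
        where
        open ≡-Reasoning
        swap : ∀ a c l → a + c + l ≡ a + l + c
        swap = solve-∀
        shuffle : ∀ n r c → n + r + c ≡ r + (n + c)
        shuffle = solve-∀

    frame-rises-0 : d < n → Rises 0 1
    frame-rises-0 d<n = from (rises-inside 0<n 1<n) (trans level-1 (sym (level-0-< d<n)))

    frame-rises-beyond : ∀ {o} → d < o → o < n → Rises o 1
    frame-rises-beyond {o} d<o o<n with <-or-wraps 1 o<n
    ... | inj₁ o+1<n = from (rises-inside o<n o+1<n)
          (trans (level-beyond (<-≤-trans d<o (m≤m+n o 1))) (sym (level-beyond d<o)))
    ... | inj₂ (0 , _ , o+1≡n) = from (rises-wrapping o<n o+1≡n 0<n)
          (trans (level-0-< (<-trans d<o o<n)) (cong suc (sym (level-beyond d<o))))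
    ... | inj₂ (suc _ , s≤s () , _)

    window-rises-odd : ∀ {o} → o < n → Odd o → o < d → Rises o 2
    window-rises-odd {o} o<n odd o<d = rises (<-or-wraps 2 o<n)
      where
      level-o : level o ≡ 1
      level-o = level-odd (odd⇒0< odd) odd (<⇒≤ o<d)
      o+2≤d : o + 2 ≤ d
      o+2≤d = odd-<-odd⇒+2≤ odd (gap-odd k) o<d
      rises : o + 2 < n ⊎ Σ ℕ (λ r → r < 2 × o + 2 ≡ n + r) → Rises o 2
      rises (inj₁ o+2<n) = from (rises-inside o<n o+2<n)
        (trans (level-odd (odd⇒0< (odd-+2 odd)) (odd-+2 odd) o+2≤d) (sym level-o))
      rises (inj₂ (0 , _ , o+2≡n)) = from (rises-wrapping o<n o+2≡n 0<n)
        (trans (level-0-≡ (≤-antisym gap≤n (subst (_≤ d) (trans o+2≡n (+-identityʳ n)) o+2≤d))) (cong suc (sym level-o)))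
      rises (inj₂ (1 , _ , o+2≡n+1)) = ⊥-elim (<⇒≱ (n<1+n n) (begin
        suc n     ≡⟨ +-comm 1 n ⟩
        n + 1     ≡⟨ sym o+2≡n+1 ⟩
        o + 2     ≤⟨ o+2≤d ⟩
        d         ≤⟨ gap≤n ⟩
        n         ∎))
        where open ≤-Reasoning
      rises (inj₂ (suc (suc _) , s≤s (s≤s ()) , _))

    window-rises-level-0 : ∀ {o} → o < n → level o ≡ 0 → (o + 2 < n → level (o + 2) ≡ 0) → (o + 2 ≡ n → d < n) → Rises o 2
    window-rises-level-0 {o} o<n level-o level-o+2 o+2≡n⇒d<n with <-or-wraps 2 o<n
    ... | inj₁ o+2<n = from (rises-inside o<n o+2<n) (trans (level-o+2 o+2<n) (sym level-o))
    ... | inj₂ (0 , _ , o+2≡n) = from (rises-wrapping o<n o+2≡n 0<n)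
          (trans (level-0-< (o+2≡n⇒d<n (trans o+2≡n (+-identityʳ n)))) (cong suc (sym level-o)))
    ... | inj₂ (1 , _ , o+2≡n+1) = from (rises-wrapping o<n o+2≡n+1 1<n) (trans level-1 (cong suc (sym level-o)))
    ... | inj₂ (suc (suc _) , s≤s (s≤s ()) , _)

    window-rises : ∀ {o} → o < n → 0 < o → o ≢ d → Rises o 2
    window-rises {o} o<n 0<o o≢d with even-or-odd o | o ≤? d
    ... | inj₂ odd | yes o≤d = window-rises-odd o<n odd (≤∧≢⇒< o≤d o≢d)
    ... | _ | no o≰d = window-rises-level-0 o<n (level-beyond (≰⇒> o≰d))
          (λ _ → level-beyond (<-≤-trans (≰⇒> o≰d) (m≤m+n o 2))) (λ _ → <-trans (≰⇒> o≰d) o<n)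
    ... | inj₁ even | yes _ = window-rises-level-0 o<n (level-even 0<o even)
          (λ _ → level-even (<-≤-trans 0<o (m≤m+n o 2)) (even-+2 even))
          (λ o+2≡n → ≤∧≢⇒< gap≤n (λ d≡n → even∧odd⇒⊥ (subst Even (trans o+2≡n (sym d≡n)) (even-+2 even)) (gap-odd k)))

    ¬window-rises-0 : ¬ Rises 0 2
    ¬window-rises-0 rises with m≤n⇒m<n∨m≡n gap≤n | to (rises-inside 0<n 2<n) rises
    ... | inj₁ d<n | level≡ = 0≢1+n (trans (sym (level-even (s≤s z≤n) (1 , refl))) (trans level≡ (level-0-< d<n)))
    ... | inj₂ d≡n | level≡ = 0≢1+n (trans (sym (level-even (s≤s z≤n) (1 , refl))) (trans level≡ (level-0-≡ d≡n)))

    ¬window-rises-gap : d < n → ¬ Rises d 2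
    ¬window-rises-gap d<n rises with <-or-wraps 2 d<n
    ... | inj₁ d+2<n = 0≢1+n (trans (sym (level-beyond (m<m+n d (s≤s z≤n))))
                          (trans (to (rises-inside d<n d+2<n) rises) (level-odd (1≤gap k) (gap-odd k) ≤-refl)))
    ... | inj₂ (0 , _ , d+2≡n) = 1+n≢n (sym (trans (sym (level-0-< d<n))
                          (trans (to (rises-wrapping d<n d+2≡n 0<n) rises) (cong suc (level-odd (1≤gap k) (gap-odd k) ≤-refl)))))
    ... | inj₂ (1 , _ , d+2≡n+1) = 1+n≢n (sym (trans (sym level-1)
                          (trans (to (rises-wrapping d<n d+2≡n+1 1<n) rises) (cong suc (level-odd (1≤gap k) (gap-odd k) ≤-refl)))))
    ... | inj₂ (suc (suc _) , s≤s (s≤s ()) , _)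

    ¬frame-rises : ∀ {t} → 1 ≤ t → t ≤ d → t < n → ¬ Rises t 1
    ¬frame-rises {t} 1≤t t≤d t<n rises with even-or-odd t | <-or-wraps 1 t<n
    ... | inj₂ odd | inj₁ t+1<n = 0≢1+n (trans (sym (level-even (m≤n+m 1 t) (subst Even (+-comm 1 t) (odd⇒even-suc odd))))
                          (trans (to (rises-inside t<n t+1<n) rises) (level-odd 1≤t odd t≤d)))
    ... | inj₂ odd | inj₂ (0 , _ , t+1≡n) = 1+n≢n (sym (trans (sym (level-0-< d<n))
                          (trans (to (rises-wrapping t<n t+1≡n 0<n) rises) (cong suc (level-odd 1≤t odd t≤d)))))
      where
      n-even : Even n
      n-even = subst Even (trans (+-comm 1 t) (trans t+1≡n (+-identityʳ n))) (odd⇒even-suc odd)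
      d<n : d < n
      d<n = ≤∧≢⇒< gap≤n (λ d≡n → even∧odd⇒⊥ (subst Even (sym d≡n) n-even) (gap-odd k))
    ... | inj₁ even | inj₁ t+1<n = 1+n≢n (trans (sym (level-odd (m≤n+m 1 t) (subst Odd (+-comm 1 t) (even⇒odd-suc even)) t+1≤d))
                          (trans (to (rises-inside t<n t+1<n) rises) (level-even 1≤t even)))
      where
      t+1≤d : t + 1 ≤ d
      t+1≤d = subst (_≤ d) (+-comm 1 t) (even-≤-odd⇒< even (gap-odd k) t≤d)
    ... | inj₁ even | inj₂ (0 , _ , t+1≡n) = 1+n≢n (trans (sym (level-0-≡ d≡n))
                          (trans (to (rises-wrapping t<n t+1≡n 0<n) rises) (cong suc (level-even 1≤t even))))
      where
      d≡n : d ≡ n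
      d≡n = ≤-antisym gap≤n (subst (_≤ d) (trans (+-comm 1 t) (trans t+1≡n (+-identityʳ n))) (even-≤-odd⇒< even (gap-odd k) t≤d))
    ... | _ | inj₂ (suc _ , s≤s () , _)

    ¬frame-rises-0 : d ≡ n → ¬ Rises 0 1
    ¬frame-rises-0 d≡n rises = 1+n≢n (trans (sym (level-0-≡ d≡n)) (trans (sym (to (rises-inside 0<n 1<n) rises)) level-1))

    rises-at : ∀ {v o} l → v ≡ ⟦ b + o ⟧ → (φ (v +ᵥ l) ≡ φ v + l) ⇔ Rises o l
    rises-at l refl = mk⇔ (λ rises → rises) (λ rises → rises)

    frame-rises : ∀ {o} → o < n → (∀ t → 1 ≤ t → t ≤ d → o ≢ t) → (d ≡ n → o ≢ 0) → Rises o 1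
    frame-rises {zero} _ _ full⇒o≢0 = frame-rises-0 (≤∧≢⇒< gap≤n (λ d≡n → full⇒o≢0 d≡n refl))
    frame-rises {suc o} o<n ¬run _ with d <? suc o
    ... | yes d<o = frame-rises-beyond d<o o<n
    ... | no d≮o = ⊥-elim (¬run (suc o) (s≤s z≤n) (≮⇒≥ d≮o) refl)

    consistent-S : ∀ x → InS k j x → Consistent φ x
    consistent-S (frame v) (_ , _ , ¬run) = from (rises-at 1 (sym (⟦+offset⟧ j v)))
      (frame-rises (offset<n j v) (λ t 1≤t t≤d o≡t → ¬run t 1≤t t≤d (cong frame (offset≡⇒≡ j o≡t))) full⇒o≢0)
      where
      full⇒o≢0 : d ≡ n → offset j v ≢ 0
      full⇒o≢0 d≡n o≡0 = ¬run n 0<n (≤-reflexive (sym d≡n)) (cong frame (trans (offset≡⇒≡ j o≡0) (sym (⟦+n⟧≡⟦+0⟧ b))))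
    consistent-S (window v) (v≢j , v≢j+d , _) = from (rises-at 2 (sym (⟦+offset⟧ j v)))
      (window-rises (offset<n j v) (n≢0⇒n>0 o≢0) o≢d)
      where
      o≢0 : offset j v ≢ 0
      o≢0 o≡0 = v≢j (cong window (trans (offset≡⇒≡ j o≡0) (⟦toℕ+0⟧ j)))
      o≢d : offset j v ≢ d
      o≢d o≡d = v≢j+d (cong window (offset≡⇒≡ j o≡d))

    ¬consistent-window-j : ¬ Consistent φ (window j)
    ¬consistent-window-j c = ¬window-rises-0 (to (rises-at 2 (sym (⟦toℕ+0⟧ j))) c)

    ¬consistent-window-j+d : ¬ Consistent φ (window (j +ᵥ d))
    ¬consistent-window-j+d c with m≤n⇒m<n∨m≡n gap≤n
    ... | inj₁ d<n = ¬window-rises-gap d<n c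
    ... | inj₂ d≡n = ¬window-rises-0 (to (rises-at 2 (trans (cong (λ o → ⟦ b + o ⟧) d≡n) (⟦+n⟧≡⟦+0⟧ b))) c)

    ¬consistent-frame : ∀ {t} → 1 ≤ t → t ≤ d → ¬ Consistent φ (frame (j +ᵥ t))
    ¬consistent-frame {t} 1≤t t≤d c with m≤n⇒m<n∨m≡n (≤-trans t≤d gap≤n)
    ... | inj₁ t<n = ¬frame-rises 1≤t t≤d t<n c
    ... | inj₂ t≡n = ¬frame-rises-0 (≤-antisym gap≤n (subst (_≤ d) t≡n t≤d))
                       (to (rises-at 1 (trans (cong (λ o → ⟦ b + o ⟧) t≡n) (⟦+n⟧≡⟦+0⟧ b))) c)

  Potential-for : Subgraph n → (Fin n → ℕ) → Set
  Potential-for H φ = ∀ x → H x ≡ true → Consistent φ x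

  module _ {H : Subgraph n} where
    open Walks H

    walk-potential : ∀ {φ} → Potential-for H φ → ∀ {u v} (w : Walk u v) → ℤ.+ φ v ≡ ℤ.+ φ u +ℤ disp w
    walk-potential {φ} pot {u} ε = sym (ℤₚ.+-identityʳ (ℤ.+ φ u))
    walk-potential {φ} pot {u} (s ◅ w) =
      trans (walk-potential pot w) (trans (cong (_+ℤ disp w) (step-potential s)) (ℤₚ.+-assoc (ℤ.+ φ u) (disp₁ s) (disp w)))
      where
      up : ∀ x → H x ≡ true → ℤ.+ φ (tgt x) ≡ ℤ.+ φ (src x) +ℤ ℤ.+ len x
      up x Hx = trans (cong ℤ.+_ (pot x Hx)) (ℤₚ.pos-+ (φ (src x)) (len x))
      step-potential : ∀ {u v} (s : Adj H u v) → ℤ.+ φ v ≡ ℤ.+ φ u +ℤ disp₁ s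
      step-potential (x , Hx , inj₁ (refl , refl)) = up x Hx
      step-potential (x , Hx , inj₂ (refl , refl)) =
        trans (cancel (ℤ.+ φ (src x)) (ℤ.+ len x)) (cong (_+ℤ - ℤ.+ len x) (sym (up x Hx)))
        where
        cancel : ∀ a l → a ≡ (a +ℤ l) +ℤ - l
        cancel = ℤ-solve-∀

    consistent-transfer : Connected H → ∀ {φ ψ} → Potential-for H φ → Potential-for H ψ →
      ∀ y → Consistent φ y → Consistent ψ y
    consistent-transfer connected {φ} {ψ} pot-φ pot-ψ y φ-fits =
      ℤₚ.+-injective (trans (walk-potential {ψ} pot-ψ w) (trans (cong (ℤ.+ ψ (src y) +ℤ_) disp≡len) (sym (ℤₚ.pos-+ (ψ (src y)) (len y)))))
      where
      w : Walk (src y) (tgt y)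
      w = connected (src y) (tgt y)
      disp≡len : disp w ≡ ℤ.+ len y
      disp≡len = ℤ+-cancelˡ (ℤ.+ φ (src y)) (trans (sym (walk-potential {φ} pot-φ w))
                   (trans (cong ℤ.+_ φ-fits) (ℤₚ.pos-+ (φ (src y)) (len y))))

  module Removed {H : Subgraph n} (connected : Connected H) {k k' j j'}
                 (gap≤n : gap k ≤ n) (gap'≤n : gap k' ≤ n)
                 (H⊆S : SubgraphOfS k j H) (H⊆S' : SubgraphOfS k' j' H) where
    private
      module P = Potential k j gap≤n
      module P' = Potential k' j' gap'≤n

      S'⇒consistent : ∀ y → InS k' j' y → Consistent P.φ y
      S'⇒consistent y y∈S' = consistent-transfer connected {P'.φ} {P.φ} (λ x Hx → P'.consistent-S x (H⊆S' x Hx))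
        (λ x Hx → P.consistent-S x (H⊆S x Hx)) y (P'.consistent-S y y∈S')

      window-removed : ∀ {v} → ¬ Consistent P.φ (window v) → v ≡ j' ⊎ v ≡ j' +ᵥ gap k'
      window-removed {v} ¬fits with v FP.≟ j' | v FP.≟ j' +ᵥ gap k'
      ... | yes v≡j' | _ = inj₁ v≡j'
      ... | no _ | yes v≡j'+d' = inj₂ v≡j'+d'
      ... | no v≢j' | no v≢j'+d' = ⊥-elim (¬fits (S'⇒consistent (window v)
            ((λ e → v≢j' (window-injective e)) , (λ e → v≢j'+d' (window-injective e)) , λ _ _ _ ())))

    window-j-removed : j ≡ j' ⊎ j ≡ j' +ᵥ gap k'
    window-j-removed = window-removed P.¬consistent-window-j

    window-j+d-removed : j +ᵥ gap k ≡ j' ⊎ j +ᵥ gap k ≡ j' +ᵥ gap k'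
    window-j+d-removed = window-removed P.¬consistent-window-j+d

    frame-j+1-removed : ¬ InS k' j' (frame (j +ᵥ 1))
    frame-j+1-removed j+1∈S' = P.¬consistent-frame ≤-refl (1≤gap k) (S'⇒consistent _ j+1∈S')

  same-start⇒same-gap : ∀ {H} → Connected H → ∀ {k k' j} → gap k ≤ n → gap k' ≤ n →
    SubgraphOfS k j H → SubgraphOfS k' j H → k ≡ k'
  same-start⇒same-gap connected {k} {k'} {j} gap≤n gap'≤n H⊆S H⊆S' =
    gap-injective (same-gap (full-or-same {k} {k'} gap≤n gap'≤n R.window-j+d-removed)
                            (full-or-same {k'} {k} gap'≤n gap≤n R'.window-j+d-removed))
    where
    module R = Removed connected {k} {k'} gap≤n gap'≤n H⊆S H⊆S'
    module R' = Removed connected {k'} {k} gap'≤n gap≤n H⊆S' H⊆S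
    full-or-same : ∀ {c c'} → gap c ≤ n → gap c' ≤ n → j +ᵥ gap c ≡ j ⊎ j +ᵥ gap c ≡ j +ᵥ gap c' → gap c ≡ n ⊎ gap c ≡ gap c'
    full-or-same {c} c≤n _ (inj₁ e) = inj₁ (+ᵥ≡self⇒≡n j (1≤gap c) c≤n e)
    full-or-same {c} {c'} c≤n c'≤n (inj₂ e) = inj₂ (⟦+⟧-injective₁ (toℕ j) (1≤gap c) (1≤gap c') c≤n c'≤n e)
    same-gap : gap k ≡ n ⊎ gap k ≡ gap k' → gap k' ≡ n ⊎ gap k' ≡ gap k → gap k ≡ gap k'
    same-gap (inj₂ e) _ = e
    same-gap (inj₁ _) (inj₂ e) = sym e
    same-gap (inj₁ d≡n) (inj₁ d'≡n) = trans d≡n (sym d'≡n)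

  -- Each of S_{n,k,j}, S_{n,k',j'} misses the windows missing from the other; for j ≢ j' this forces
  -- j' = j + d, j = j' + d' and d + d' = n, and then e_{j+1} lies in S_{n,k',j'} but not in S_{n,k,j}.
  same-start : ∀ {H} → Connected H → ∀ {k k' j j'} → gap k ≤ n → gap k' ≤ n →
    SubgraphOfS k j H → SubgraphOfS k' j' H → j ≡ j'
  same-start connected {k} {k'} {j} {j'} gap≤n gap'≤n H⊆S H⊆S' with j FP.≟ j'
  ... | yes j≡j' = j≡j'
  ... | no j≢j' = ⊥-elim (crossed R.window-j-removed R'.window-j-removed)
    where
    module R = Removed connected {k} {k'} gap≤n gap'≤n H⊆S H⊆S'
    module R' = Removed connected {k'} {k} gap'≤n gap≤n H⊆S' H⊆S
    b : ℕ
    b = toℕ j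
    d d' : ℕ
    d = gap k
    d' = gap k'
    crossed : j ≡ j' ⊎ j ≡ j' +ᵥ d' → j' ≡ j ⊎ j' ≡ j +ᵥ d → ⊥
    crossed (inj₁ j≡j') _ = j≢j' j≡j'
    crossed _ (inj₁ j'≡j) = j≢j' (sym j'≡j)
    crossed (inj₂ j≡j'+d') (inj₂ j'≡j+d) = R.frame-j+1-removed ((λ ()) , (λ ()) , frame-j+1-kept)
      where
      d<n : d < n
      d<n = ≤∧≢⇒< gap≤n (λ d≡n → j≢j' (sym (trans j'≡j+d (trans (cong (j +ᵥ_) d≡n) (⟦toℕ+n⟧ j)))))
      j'+t≡ : ∀ t → j' +ᵥ t ≡ ⟦ b + (d + t) ⟧
      j'+t≡ t = trans (cong (_+ᵥ t) j'≡j+d) (+ᵥ-assoc j d t)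
      d+d'≡n : d + d' ≡ n
      d+d'≡n = ⟦+⟧≡⟦⟧⇒≡n b (≤-trans (1≤gap k) (m≤m+n d d')) (+-mono-<-≤ d<n gap'≤n)
                 (trans (sym (j'+t≡ d')) (trans (sym j≡j'+d') (sym (⟦toℕ⟧ j))))
      frame-j+1-kept : ∀ t → 1 ≤ t → t ≤ d' → frame (j +ᵥ 1) ≢ frame (j' +ᵥ t)
      frame-j+1-kept t 1≤t t≤d' e = <⇒≢ (+-mono-≤ (1≤gap k) 1≤t)
        (⟦+⟧-injective₁ b ≤-refl (≤-trans (1≤gap k) (m≤m+n d t)) (<⇒≤ 1<n)
          (subst (d + t ≤_) d+d'≡n (+-monoʳ-≤ d t≤d')) (trans (frame-injective e) (j'+t≡ t)))

  S-unique : ∀ {H} → Connected H → ∀ {k k' j j'} → gap k ≤ n → gap k' ≤ n →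
    SubgraphOfS k j H → SubgraphOfS k' j' H → k ≡ k' × j ≡ j'
  S-unique connected {k} {k'} gap≤n gap'≤n H⊆S H⊆S' with same-start connected {k} {k'} gap≤n gap'≤n H⊆S H⊆S'
  ... | refl = same-start⇒same-gap connected {k} {k'} gap≤n gap'≤n H⊆S H⊆S' , refl

  -- S_{n,k,j} is a nontrivial connected convex spanning subgraph

  _≟ᴱ_ : (x y : Edge n) → Dec (x ≡ y)
  frame u ≟ᴱ frame v = map′ (cong frame) frame-injective (u FP.≟ v)
  window u ≟ᴱ window v = map′ (cong window) window-injective (u FP.≟ v)
  frame _ ≟ᴱ window _ = no (λ ())
  window _ ≟ᴱ frame _ = no (λ ())

  InS? : ∀ k j x → Dec (InS k j x)
  InS? k j x = ¬? (x ≟ᴱ window j) ×-dec ¬? (x ≟ᴱ window (j +ᵥ gap k)) ×-dec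
    map′ (λ kept → λ { zero () ; (suc t) _ t≤d → kept {t} t≤d }) (λ kept {t} t<d → kept (suc t) (s≤s z≤n) t<d)
         (allUpTo? (λ t → ¬? (x ≟ᴱ frame (j +ᵥ suc t))) (gap k))

  S : ℕ → Fin n → Subgraph n
  S k j x = ⌊ InS? k j x ⌋

  InS⇒S : ∀ {k j} x → InS k j x → S k j x ≡ true
  InS⇒S {k} {j} x x∈S = trans (isYes≗does (InS? k j x)) (dec-true (InS? k j x) x∈S)

  ¬InS⇒S : ∀ {k j} x → ¬ InS k j x → S k j x ≡ false
  ¬InS⇒S {k} {j} x x∉S = trans (isYes≗does (InS? k j x)) (dec-false (InS? k j x) x∉S)

  S⇒InS : ∀ {k j} x → S k j x ≡ true → InS k j x
  S⇒InS {k} {j} x with InS? k j x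
  ... | yes x∈S = λ _ → x∈S
  ... | no _ = λ ()

  ⊆S : ∀ {k j G} → SubgraphOfS k j G → G ⊆ᴱ S k j
  ⊆S {k} {j} G⊆S x Gx = InS⇒S {k} {j} x (G⊆S x Gx)

  Adj-sym : ∀ {H : Subgraph n} {u v} → Adj H u v → Adj H v u
  Adj-sym (x , Hx , inj₁ ends) = x , Hx , inj₂ ends
  Adj-sym (x , Hx , inj₂ ends) = x , Hx , inj₁ ends

  module S-graph (k : ℕ) (j : Fin n) (gap≤n : gap k ≤ n) where
    open Positions (S k j)
    open Walks (S k j)

    d b : ℕ
    d = gap k
    b = toℕ j

    frame-kept : ∀ {o} → d < o → o ≤ n → E (b + o) ≡ true
    frame-kept {o} d<o o≤n = InS⇒S {k} {j} _ ((λ ()) , (λ ()) , λ t 1≤t t≤d e →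
      <⇒≢ (≤-<-trans t≤d d<o) (sym (⟦+⟧-injective₁ b (≤-trans (1≤gap k) (<⇒≤ d<o)) 1≤t o≤n (≤-trans t≤d gap≤n) (frame-injective e))))

    window-kept : ∀ {o} → 1 ≤ o → o < n → o ≢ d → F (b + o) ≡ true
    window-kept {o} 1≤o o<n o≢d = InS⇒S {k} {j} _ (≢j , ≢j+d , λ _ _ _ ())
      where
      ≢j : window ⟦ b + o ⟧ ≢ window j
      ≢j e = <⇒≢ o<n (⟦+⟧≡⟦⟧⇒≡n b 1≤o (<-trans o<n (m<m+n n 0<n)) (trans (window-injective e) (sym (⟦toℕ⟧ j))))
      ≢j+d : window ⟦ b + o ⟧ ≢ window (j +ᵥ d)
      ≢j+d e = o≢d (⟦+⟧-injective₁ b 1≤o (1≤gap k) (<⇒≤ o<n) gap≤n (window-injective e))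

    frame-removed : ∀ {t} → 1 ≤ t → t ≤ d → E (b + t) ≡ false
    frame-removed {t} 1≤t t≤d = ¬InS⇒S {k} {j} _ (λ x∈S → proj₂ (proj₂ x∈S) t 1≤t t≤d refl)

    window-j-removed : S k j (window j) ≡ false
    window-j-removed = ¬InS⇒S {k} {j} _ (λ x∈S → proj₁ x∈S refl)

    window-j+d-removed : F (b + d) ≡ false
    window-j+d-removed = ¬InS⇒S {k} {j} _ (λ x∈S → proj₁ (proj₂ x∈S) refl)

    beyond-to-1 : ∀ {o} → d < o → o ≤ n → Walk ⟦ b + o ⟧ ⟦ b + 1 ⟧
    beyond-to-1 {o} d<o o≤n = subst (Walk _) wraps (proj₁ (frame-steps (b + o) (suc (n ∸ o)) kept))
      where
      kept : ∀ i → i < suc (n ∸ o) → E (b + o + i) ≡ true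
      kept i i≤n∸o = subst (λ p → E p ≡ true) (sym (+-assoc b o i)) (frame-kept (<-≤-trans d<o (m≤m+n o i))
        (subst (o + i ≤_) (m+[n∸m]≡n o≤n) (+-monoʳ-≤ o (s≤s⁻¹ i≤n∸o))))
      shuffle : ∀ b o m → b + o + suc m ≡ b + 1 + (o + m)
      shuffle = solve-∀
      wraps : ⟦ b + o + suc (n ∸ o) ⟧ ≡ ⟦ b + 1 ⟧
      wraps = trans (cong ⟦_⟧ (trans (shuffle b o (n ∸ o)) (cong (b + 1 +_) (m+[n∸m]≡n o≤n)))) (⟦p+n⟧ (b + 1))

    1-to-odd : ∀ q → 2 * q + 1 ≤ d → Walk ⟦ b + 1 ⟧ ⟦ b + (2 * q + 1) ⟧
    1-to-odd q 2q+1≤d = subst (Walk _) (cong ⟦_⟧ (shuffle b q)) (proj₁ (window-steps (b + 1) q kept))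
      where
      shuffle : ∀ b q → b + 1 + 2 * q ≡ b + (2 * q + 1)
      shuffle = solve-∀
      kept : ∀ i → i < q → F (b + 1 + 2 * i) ≡ true
      kept i i<q = subst (λ p → F p ≡ true) (sym (+-assoc b 1 (2 * i)))
        (window-kept (s≤s z≤n) (<-≤-trans 1+2i<d gap≤n) (<⇒≢ 1+2i<d))
        where
        1+2i<d : 1 + 2 * i < d
        1+2i<d = <-≤-trans (subst (_< 2 * q + 1) (+-comm (2 * i) 1) (+-monoˡ-< 1 (*-monoʳ-< 2 i<q))) 2q+1≤d

    even-to-1 : ∀ q → 1 ≤ q → 2 * q ≤ d → Walk ⟦ b + 2 * q ⟧ ⟦ b + 1 ⟧
    even-to-1 q 1≤q 2q≤d =
      proj₁ (window-steps (b + 2 * q) (suc (k ∸ q)) kept) ◅◅ subst (λ v → Walk v _) (cong ⟦_⟧ lands) last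
      where
      q≤k : q ≤ k
      q≤k = ≮⇒≥ (λ k<q → <⇒≱ (gap<2* k<q) 2q≤d)
      lands : b + (d + 1) ≡ b + 2 * q + 2 * suc (k ∸ q)
      lands = trans (cong (λ k → b + (2 * k + 1 + 1)) (sym (m+[n∸m]≡n q≤k))) (regroup b q (k ∸ q))
        where
        regroup : ∀ b q r → b + (2 * (q + r) + 1 + 1) ≡ b + 2 * q + 2 * suc r
        regroup = solve-∀
      kept : ∀ i → i < suc (k ∸ q) → F (b + 2 * q + 2 * i) ≡ true
      kept i i≤k∸q = subst (λ p → F p ≡ true) (sym (+-assoc b (2 * q) (2 * i)))
        (window-kept 1≤ (<-≤-trans <d gap≤n) (<⇒≢ <d))
        where
        1≤ : 1 ≤ 2 * q + 2 * i
        1≤ = ≤-trans 1≤q (≤-trans (m≤m+n q (q + 0)) (m≤m+n (2 * q) (2 * i)))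
        <d : 2 * q + 2 * i < d
        <d = ≤-<-trans (subst (_≤ 2 * k) (*-distribˡ-+ 2 q i)
               (*-monoʳ-≤ 2 (subst (q + i ≤_) (m+[n∸m]≡n q≤k) (+-monoʳ-≤ q (s≤s⁻¹ i≤k∸q)))))
               (m<m+n (2 * k) (s≤s z≤n))
      last : Walk ⟦ b + (d + 1) ⟧ ⟦ b + 1 ⟧
      last with m≤n⇒m<n∨m≡n gap≤n
      ... | inj₁ d<n = beyond-to-1 (m<m+n d (s≤s z≤n)) (subst (_≤ n) (+-comm 1 d) d<n)
      ... | inj₂ d≡n = subst (λ v → Walk v _) wraps ε
        where
        shuffle : ∀ b n → b + 1 + n ≡ b + (n + 1)
        shuffle = solve-∀
        wraps : ⟦ b + 1 ⟧ ≡ ⟦ b + (d + 1) ⟧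
        wraps = trans (sym (⟦p+n⟧ (b + 1))) (cong ⟦_⟧ (trans (shuffle b n) (cong (λ d → b + (d + 1)) (sym d≡n))))

    1-to : ∀ {o} → o < n → Walk ⟦ b + 1 ⟧ ⟦ b + o ⟧
    1-to {o} o<n with d <? o | even-or-odd o
    ... | yes d<o | _ = reverse Adj-sym (beyond-to-1 d<o (<⇒≤ o<n))
    ... | no d≮o | inj₂ (q , refl) = 1-to-odd q (≮⇒≥ d≮o)
    ... | no d≮o | inj₁ (suc q , refl) = reverse Adj-sym (even-to-1 (suc q) (s≤s z≤n) (≮⇒≥ d≮o))
    ... | no _ | inj₁ (zero , refl) with m≤n⇒m<n∨m≡n gap≤n
    ...   | inj₁ d<n = subst (Walk _) (⟦+n⟧≡⟦+0⟧ b) (reverse Adj-sym (beyond-to-1 d<n ≤-refl))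
    ...   | inj₂ d≡n = subst (Walk _) (trans (cong (λ d → ⟦ b + d ⟧) d≡n) (⟦+n⟧≡⟦+0⟧ b)) (1-to-odd k ≤-refl)

    connected : Connected (S k j)
    connected u v = reverse Adj-sym (1-to-vertex u) ◅◅ 1-to-vertex v
      where
      1-to-vertex : ∀ v → Walk ⟦ b + 1 ⟧ v
      1-to-vertex v = subst (Walk _) (⟦+offset⟧ j v) (1-to (offset<n j v))

    E-removed-suc : ∀ {t} → suc t ≤ d → E (suc (b + t)) ≡ false
    E-removed-suc {t} 1+t≤d = subst (λ p → E p ≡ false) (+-suc b t) (frame-removed (s≤s z≤n) 1+t≤d)

    convex-at : ∀ {m} → m < n → Convex-at (b + m)
    convex-at {zero} _ = inj₁ (count≤1-¬₂₃ (E (b + 0)) (E-removed-suc (1≤gap k))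
                          (subst (λ v → S k j (window v) ≡ false) (sym (⟦toℕ+0⟧ j)) window-j-removed))
    convex-at {suc m} 1+m<n with d <? suc m
    ... | yes d<1+m = inj₂ (frame-kept d<1+m (<⇒≤ 1+m<n) ,
                            subst (λ p → E p ≡ true) (+-suc b (suc m)) (frame-kept (m<n⇒m<1+n d<1+m) 1+m<n) ,
                            window-kept (s≤s z≤n) 1+m<n (λ e → <⇒≢ d<1+m (sym e)))
    ... | no d≮1+m with m≤n⇒m<n∨m≡n (≮⇒≥ d≮1+m)
    ...   | inj₁ 1+m<d = inj₁ (count≤1-¬₁₂ (F (b + suc m)) (frame-removed (s≤s z≤n) (<⇒≤ 1+m<d)) (E-removed-suc 1+m<d))
    ...   | inj₂ 1+m≡d = inj₁ (count≤1-¬₁₃ (E (suc (b + suc m))) (frame-removed (s≤s z≤n) (≤-reflexive 1+m≡d))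
                                 (subst (λ o → F (b + o) ≡ false) (sym 1+m≡d) window-j+d-removed))

    convex : Convex (S k j)
    convex = Convex-from b convex-at

    nontrivial : Nontrivial (S k j)
    nontrivial = (λ full → true≢false (full (window j)) window-j-removed) ,
                 (λ _ window-cycle → true≢false (proj₁ (window-cycle j)) window-j-removed)

  -- Every nontrivial connected convex spanning subgraph is some S_{n,k,j}

  module Classification (H : Subgraph n) (connected : Connected H) (convex : Convex H) where
    open Positions H
    open Walks H

    convex-at : ∀ p → Convex-at p
    convex-at = convex⇒Convex-at convex

    frame-end⇒window-removed : ∀ {p} → E p ≡ true → E (suc p) ≡ false → F p ≡ false
    frame-end⇒window-removed {p} Ep E-suc-p = ¬-not (λ Fp → true≢false (triangle-closed₂ Ep Fp (convex-at p)) E-suc-p)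

    frame-start⇒window-removed : ∀ {p} → E p ≡ false → E (suc p) ≡ true → F p ≡ false
    frame-start⇒window-removed {p} Ep E-suc-p = ¬-not (λ Fp → true≢false (triangle-closed₁ E-suc-p Fp (convex-at p)) Ep)

    window-removed⇒frame-removed : ∀ {p} → F p ≡ false → E p ≡ false ⊎ E (suc p) ≡ false
    window-removed⇒frame-removed {p} Fp with E p in Ep | E (suc p) in E-suc-p
    ... | false | _ = inj₁ refl
    ... | true | false = inj₂ refl
    ... | true | true = ⊥-elim (true≢false (triangle-closed₃ Ep E-suc-p (convex-at p)) Fp)

    frames⇒window : ∀ {p} → E p ≡ true → E (suc p) ≡ true → F p ≡ true
    frames⇒window {p} Ep E-suc-p = triangle-closed₃ Ep E-suc-p (convex-at p)

    StepPreserves : (ℕ → Bool) → ℕ → ℕ → Set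
    StepPreserves L o l = (o + l < n → L (o + l) ≡ L o) × (∀ {r} → r < l → o + l ≡ n + r → L r ≡ L o)

    offset-label-constant : ∀ a (L : ℕ → Bool) →
      (∀ {o} → o < n → E (a + o) ≡ true → StepPreserves L o 1) →
      (∀ {o} → o < n → F (a + o) ≡ true → StepPreserves L o 2) →
      ∀ {o o'} → o < n → o' < n → L o ≡ L o'
    offset-label-constant a L frame-preserves window-preserves {o} {o'} o<n o'<n =
      trans (sym (cong L (offset-⟦+⟧ j o<n))) (trans (constant (connected _ _)) (cong L (offset-⟦+⟧ j o'<n)))
      where
      j : Fin n
      j = ⟦ a ⟧
      ℓ : Fin n → Bool
      ℓ v = L (offset j v)
      ⟦j+⟧ : ∀ o → ⟦ toℕ j + o ⟧ ≡ ⟦ a + o ⟧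
      ⟦j+⟧ o = ⟦⟧+ᵥ a o
      src≡ : ∀ x → ⟦ a + offset j (src x) ⟧ ≡ src x
      src≡ x = trans (sym (⟦j+⟧ _)) (⟦+offset⟧ j (src x))
      step-preserves : ∀ x → H x ≡ true → StepPreserves L (offset j (src x)) (len x)
      step-preserves (frame v) Hv = frame-preserves (offset<n j v) (trans (cong (λ w → H (frame w)) (src≡ (frame v))) Hv)
      step-preserves (window v) Hv = window-preserves (offset<n j v) (trans (cong (λ w → H (window w)) (src≡ (window v))) Hv)
      tgt-at : ∀ x → tgt x ≡ ⟦ toℕ j + offset j (src x) ⟧ +ᵥ len x
      tgt-at x = trans (tgt≡src+ᵥlen x) (cong (_+ᵥ len x) (sym (⟦+offset⟧ j (src x))))
      preserved : ∀ x → H x ≡ true → ℓ (src x) ≡ ℓ (tgt x)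
      preserved x Hx with <-or-wraps (len x) (offset<n j (src x))
      ... | inj₁ o+l<n = sym (trans (cong L (trans (cong (offset j) (tgt-at x)) (offset-+ᵥ j o+l<n)))
                                    (proj₁ (step-preserves x Hx) o+l<n))
      ... | inj₂ (r , r<l , o+l≡) = sym (trans (cong L (trans (cong (offset j) (tgt-at x)) (offset-+ᵥ-wrap j o+l≡ r<n)))
                                    (proj₂ (step-preserves x Hx) r<l o+l≡))
        where
        r<n : r < n
        r<n = <-≤-trans r<l (<⇒≤ (<n (≤-trans (len≤2 x) (s≤s (s≤s z≤n)))))
      constant : ∀ {u v} → Walk u v → ℓ u ≡ ℓ v
      constant ε = refl
      constant ((x , Hx , inj₁ (refl , refl)) ◅ w) = trans (preserved x Hx) (constant w)
      constant ((x , Hx , inj₂ (refl , refl)) ◅ w) = trans (sym (preserved x Hx)) (constant w)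

    module EvenGapLabel {a e} (even-e : Even e) (e<n : e < n) (gap-at-a : Gap e a) where
      Fa : F a ≡ false
      Fa = proj₁ gap-at-a
      Fa+e : F (a + e) ≡ false
      Fa+e = proj₁ (proj₂ gap-at-a)
      E-run : ∀ t → 1 ≤ t → t ≤ e → E (a + t) ≡ false
      E-run = proj₂ (proj₂ gap-at-a)
      Inner : ℕ → Set
      Inner o = Even o × 2 ≤ o × o ≤ e
      inner? : ∀ o → Dec (Inner o)
      inner? o = even? o ×-dec 2 ≤? o ×-dec o ≤? e
      L : ℕ → Bool
      L o = does (inner? o)
      ¬inner-0 : ¬ Inner 0
      ¬inner-0 (_ , () , _)
      ¬inner-1 : ¬ Inner 1
      ¬inner-1 (_ , s≤s () , _)
      L0≡false : L 0 ≡ false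
      L0≡false = dec-false (inner? 0) ¬inner-0
      L<2≡false : ∀ {r} → r < 2 → L r ≡ false
      L<2≡false {zero} _ = L0≡false
      L<2≡false {suc zero} _ = dec-false (inner? 1) ¬inner-1
      L<2≡false {suc (suc _)} (s≤s (s≤s ()))
      frame-preserves : ∀ {o} → o < n → E (a + o) ≡ true → StepPreserves L o 1
      frame-preserves {zero} _ _ = (λ _ → trans (L<2≡false (s≤s (s≤s z≤n))) (sym L0≡false)) ,
                                   (λ { {zero} _ 1≡n → ⊥-elim (<⇒≢ 1<n (trans 1≡n (+-identityʳ n))) ; {suc _} (s≤s ()) _ })
      frame-preserves {suc o} o<n Ea+o with e <? suc o
      ... | no e≮o = ⊥-elim (true≢false Ea+o (E-run (suc o) (s≤s z≤n) (≮⇒≥ e≮o)))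
      ... | yes e<o = (λ _ → trans (beyond (<-trans e<o (m<m+n (suc o) (s≤s z≤n)))) (sym (beyond e<o))) ,
                      (λ { {zero} _ _ → trans L0≡false (sym (beyond e<o)) ; {suc _} (s≤s ()) _ })
        where
        beyond : ∀ {o} → e < o → L o ≡ false
        beyond e<o = dec-false (inner? _) (λ (_ , _ , o≤e) → <⇒≱ e<o o≤e)
      window-preserves : ∀ {o} → o < n → F (a + o) ≡ true → StepPreserves L o 2
      window-preserves {o} o<n Fa+o = inside , wrapping
        where
        o≢0 : o ≢ 0
        o≢0 refl = true≢false (trans (cong F (sym (+-identityʳ a))) Fa+o) Fa
        o≢e : o ≢ e
        o≢e refl = true≢false Fa+o Fa+e
        inner-step : Inner o → o + 2 ≤ e
        inner-step (even-o , _ , o≤e) = subst (_≤ e) (+-comm 2 o) (≤∧≢⇒< (≤∧≢⇒< o≤e o≢e)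
          (λ 1+o≡e → even∧odd⇒⊥ (subst Even (sym 1+o≡e) even-e) (even⇒odd-suc even-o)))
        inside : o + 2 < n → L (o + 2) ≡ L o
        inside _ = does-⇔ (mk⇔ back forth) (inner? (o + 2)) (inner? o)
          where
          back : Inner (o + 2) → Inner o
          back (even-o+2 , _ , o+2≤e) =
            even-+2⁻¹ even-o+2 , even-≢0⇒2≤ (even-+2⁻¹ even-o+2) o≢0 , ≤-trans (m≤m+n o 2) o+2≤e
          forth : Inner o → Inner (o + 2)
          forth inner@(even-o , 2≤o , _) = even-+2 even-o , ≤-trans 2≤o (m≤m+n o 2) , inner-step inner
        wrapping : ∀ {r} → r < 2 → o + 2 ≡ n + r → L r ≡ L o
        wrapping {r} r<2 o+2≡ = trans (L<2≡false r<2) (sym (dec-false (inner? o) (λ inner →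
          <⇒≱ (≤-<-trans (inner-step inner) e<n) (subst (n ≤_) (sym o+2≡) (m≤m+n n r)))))
      L1≡L2 : L 1 ≡ L 2
      L1≡L2 = offset-label-constant a L frame-preserves window-preserves 1<n 2<n

    ¬even-gap : ∀ {a e} → Even e → 2 ≤ e → e < n → ¬ Gap e a
    ¬even-gap even-e 2≤e e<n gap-at-a =
      true≢false (trans L1≡L2 (dec-true (inner? 2) ((1 , refl) , ≤-refl , 2≤e))) (L<2≡false (s≤s (s≤s z≤n)))
      where open EvenGapLabel even-e e<n gap-at-a

    RunOf : ℕ → ℕ → Set
    RunOf p d = d < n × Gap d p × E (p + d + 1) ≡ true × (∀ i → 0 < i → i < d → F (p + i) ≡ true)

    run-of-length : ∀ {p} r → E p ≡ true → E (suc p) ≡ false → r < n → E (suc p + r) ≡ true →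
      (∀ r' → r' < r → E (suc p + r') ≡ false) → Σ ℕ λ q → RunOf p (gap q)
    run-of-length {p} r Ep E-suc-p r<n E-end before-end = odd-run (even-or-odd r)
      where
      r≢0 : r ≢ 0
      r≢0 r≡0 = true≢false (trans (cong E (sym (trans (cong (suc p +_) r≡0) (+-identityʳ (suc p))))) E-end) E-suc-p
      missing : ∀ t → 1 ≤ t → t ≤ r → E (p + t) ≡ false
      missing (suc t) _ t<r = trans (cong E (+-suc p t)) (before-end t t<r)
      Fp : F p ≡ false
      Fp = frame-end⇒window-removed Ep E-suc-p
      Fp+r : F (p + r) ≡ false
      Fp+r = frame-start⇒window-removed (missing r (n≢0⇒n>0 r≢0) ≤-refl) E-end
      inner : Odd r → ∀ i → 0 < i → i < r → F (p + i) ≡ true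
      inner odd-r i 0<i i<r = ¬-not (window-missing (even-or-odd i))
        where
        window-missing : Even i ⊎ Odd i → F (p + i) ≢ false
        window-missing (inj₁ even-i) Fp+i = ¬even-gap even-i (even-≢0⇒2≤ even-i (λ i≡0 → <⇒≢ 0<i (sym i≡0)))
          (<-trans i<r r<n) (Fp , Fp+i , λ t 1≤t t≤i → missing t 1≤t (≤-trans t≤i (<⇒≤ i<r)))
        window-missing (inj₂ odd-i) Fp+i = ¬even-gap even-r∸i (even-≢0⇒2≤ even-r∸i r∸i≢0) (≤-<-trans (m∸n≤m r i) r<n)
          (Fp+i , subst (λ z → F z ≡ false) (sym p+i+[r∸i]≡p+r) Fp+r , λ t 1≤t t≤r∸i →
            trans (cong E (+-assoc p i t)) (missing (i + t) (≤-trans 1≤t (m≤n+m t i))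
              (subst (i + t ≤_) (m+[n∸m]≡n (<⇒≤ i<r)) (+-monoʳ-≤ i t≤r∸i))))
          where
          even-r∸i : Even (r ∸ i)
          even-r∸i = odd∸odd odd-i odd-r
          r∸i≢0 : r ∸ i ≢ 0
          r∸i≢0 r∸i≡0 = <⇒≱ i<r (m∸n≡0⇒m≤n r∸i≡0)
          p+i+[r∸i]≡p+r : p + i + (r ∸ i) ≡ p + r
          p+i+[r∸i]≡p+r = trans (+-assoc p i (r ∸ i)) (cong (p +_) (m+[n∸m]≡n (<⇒≤ i<r)))
      odd-run : Even r ⊎ Odd r → Σ ℕ λ q → RunOf p (gap q)
      odd-run (inj₁ even-r) = ⊥-elim (¬even-gap even-r (even-≢0⇒2≤ even-r r≢0) r<n (Fp , Fp+r , missing))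
      odd-run (inj₂ odd-r@(q , r≡)) = q , subst (RunOf p) r≡
        (r<n , (Fp , Fp+r , missing) , trans (cong E (+-comm (p + r) 1)) E-end , inner odd-r)

    run-after-frame : ∀ {p} → E p ≡ true → E (suc p) ≡ false → Σ ℕ λ q → RunOf p (gap q)
    run-after-frame {p} Ep E-suc-p with least-false (λ r → not (E (suc p + r))) n
    ... | inj₁ none = ⊥-elim (true≢false (trans (E-+n p) Ep)
          (subst (λ z → E z ≡ false) (wraps 0<n) (not-injective (none (n ∸ 1) (∸-monoʳ-< {n} {1} {0} (s≤s z≤n) 0<n)))))
      where
      wraps : ∀ {m} → 0 < m → suc p + (m ∸ 1) ≡ p + m
      wraps {suc m} _ = sym (+-suc p m)
    ... | inj₂ (r , r<n , E-end , before-end) =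
          run-of-length r Ep E-suc-p r<n (not-injective E-end) (λ r' r'<r → not-injective (before-end r' r'<r))

    Classified : Set
    Classified = Σ ℕ λ q → gap q ≤ n × Σ (Fin n) λ j → ∀ x → H x ≡ S q j x

    module FromFrameEnd {p} (Ep : E p ≡ true) (E-suc-p : E (suc p) ≡ false) where
      q : ℕ
      q = proj₁ (run-after-frame Ep E-suc-p)

      d : ℕ
      d = gap q

      run : RunOf p d
      run = proj₂ (run-after-frame Ep E-suc-p)

      d<n : d < n
      d<n = proj₁ run

      H⊆S : SubgraphOfS q ⟦ p ⟧ H
      H⊆S = Gap⇒SubgraphOfS {q} (proj₁ (proj₂ run))

      unique-frame-end : ∀ {p'} → E p' ≡ true → E (suc p') ≡ false → ⟦ p ⟧ ≡ ⟦ p' ⟧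
      unique-frame-end Ep' E-suc-p' with run-after-frame Ep' E-suc-p'
      ... | q' , d'<n , gap' , _ = proj₂ (S-unique connected {q} {q'} (<⇒≤ d<n) (<⇒≤ d'<n) H⊆S (Gap⇒SubgraphOfS {q'} gap'))

      frames-beyond : ∀ {o} → d < o → o < n → E (p + o) ≡ true
      frames-beyond {o} d<o o<n = ¬-not (λ Ep+o → no-other-end
          (frame-end-between (o ∸ (d + 1)) (proj₁ (proj₂ (proj₂ run))) (subst (λ z → E z ≡ false) (sym lands) Ep+o)))
        where
        assoc : ∀ p d x → p + d + 1 + x ≡ p + (d + 1 + x)
        assoc = solve-∀
        d+1≤o : d + 1 ≤ o
        d+1≤o = subst (_≤ o) (+-comm 1 d) d<o
        lands : p + d + 1 + (o ∸ (d + 1)) ≡ p + o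
        lands = trans (assoc p d (o ∸ (d + 1))) (cong (p +_) (m+[n∸m]≡n d+1≤o))
        no-other-end : ¬ (Σ ℕ λ i → i < o ∸ (d + 1) × E (p + d + 1 + i) ≡ true × E (suc (p + d + 1 + i)) ≡ false)
        no-other-end (i , i<o∸[d+1] , Ei , E-suc-i) = ⟦⟧≢⟦+⟧ p (≤-trans (m≤n+m 1 d) (m≤m+n (d + 1) i))
          (<-trans (subst (d + 1 + i <_) (m+[n∸m]≡n d+1≤o) (+-monoʳ-< (d + 1) i<o∸[d+1])) o<n)
          (trans (unique-frame-end Ei E-suc-i) (cong ⟦_⟧ (assoc p d i)))

      frame-at : ∀ {o} → o < n → (∀ t → 1 ≤ t → t ≤ d → o ≢ t) → E (p + o) ≡ true
      frame-at {zero} _ _ = trans (cong E (+-identityʳ p)) Ep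
      frame-at {suc o} o<n ¬run with d <? suc o
      ... | yes d<o = frames-beyond d<o o<n
      ... | no d≮o = ⊥-elim (¬run (suc o) (s≤s z≤n) (≮⇒≥ d≮o) refl)

      window-at : ∀ {o} → o < n → 0 < o → o ≢ d → F (p + o) ≡ true
      window-at {o} o<n 0<o o≢d with <-cmp o d
      ... | tri< o<d _ _ = proj₂ (proj₂ (proj₂ run)) o 0<o o<d
      ... | tri≈ _ o≡d _ = ⊥-elim (o≢d o≡d)
      ... | tri> _ _ d<o = ¬-not (λ Fp+o → frame-missing (window-removed⇒frame-removed Fp+o))
        where
        frame-missing : E (p + o) ≡ false ⊎ E (suc (p + o)) ≡ false → ⊥
        frame-missing (inj₁ Ep+o) = true≢false (frames-beyond d<o o<n) Ep+o
        frame-missing (inj₂ E-suc) with <-or-wraps 1 o<n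
        ... | inj₁ o+1<n = true≢false (trans (cong E (trans (sym (+-suc p o)) (cong (p +_) (+-comm 1 o))))
                             (frames-beyond (<-trans d<o (m<m+n o (s≤s z≤n))) o+1<n)) E-suc
        ... | inj₂ (0 , _ , o+1≡n) = true≢false (trans (cong E suc[p+o]≡p+n) (trans (E-+n p) Ep)) E-suc
          where
          suc[p+o]≡p+n : suc (p + o) ≡ p + n
          suc[p+o]≡p+n = trans (sym (+-suc p o)) (cong (p +_) (trans (+-comm 1 o) (trans o+1≡n (+-identityʳ n))))
        ... | inj₂ (suc _ , s≤s () , _)

      S⊆H : ∀ x → InS q ⟦ p ⟧ x → H x ≡ true
      S⊆H (frame v) (_ , _ , ¬run) = subst (λ w → H (frame w) ≡ true) (⟦p+offset⟧ p v)
        (frame-at (offset<n ⟦ p ⟧ v) (λ t 1≤t t≤d o≡t → ¬run t 1≤t t≤d (cong frame (offset≡⇒≡ ⟦ p ⟧ o≡t))))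
      S⊆H (window v) (v≢p , v≢p+d , _) = subst (λ w → H (window w) ≡ true) (⟦p+offset⟧ p v)
        (window-at (offset<n ⟦ p ⟧ v) (n≢0⇒n>0 o≢0) o≢d)
        where
        o≢0 : offset ⟦ p ⟧ v ≢ 0
        o≢0 o≡0 = v≢p (cong window (trans (offset≡⇒≡ ⟦ p ⟧ o≡0) (⟦toℕ+0⟧ ⟦ p ⟧)))
        o≢d : offset ⟦ p ⟧ v ≢ d
        o≢d o≡d = v≢p+d (cong window (offset≡⇒≡ ⟦ p ⟧ o≡d))

      classified : Classified
      classified = q , <⇒≤ d<n , ⟦ p ⟧ , ⊆ᴱ-antisym (⊆S {q} H⊆S) (λ x Sx → S⊆H x (S⇒InS {q} x Sx))

    module Frameless (no-frames : ∀ p → E p ≡ false) where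

      ¬even-n : ¬ Even n
      ¬even-n even-n = true≢false (dec-true (even? 0) (0 , refl))
                                  (trans L0≡L1 (dec-false (even? 1) (λ even-1 → even∧odd⇒⊥ even-1 (0 , refl))))
        where
        L : ℕ → Bool
        L o = does (even? o)
        frame-preserves : ∀ {o} → o < n → E (0 + o) ≡ true → StepPreserves L o 1
        frame-preserves {o} _ E0+o = ⊥-elim (true≢false E0+o (no-frames o))
        window-preserves : ∀ {o} → o < n → F (0 + o) ≡ true → StepPreserves L o 2
        window-preserves {o} _ _ = (λ _ → does-⇔ (mk⇔ even-+2⁻¹ even-+2) (even? (o + 2)) (even? o)) , wrapping
          where
          wrapping : ∀ {r} → r < 2 → o + 2 ≡ n + r → L r ≡ L o
          wrapping {zero} _ o+2≡n = trans (dec-true (even? 0) (0 , refl))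
            (sym (dec-true (even? o) (even-+2⁻¹ (subst Even (sym (trans o+2≡n (+-identityʳ n))) even-n))))
          wrapping {suc zero} _ o+2≡n+1 = trans (dec-false (even? 1) (λ even-1 → even∧odd⇒⊥ even-1 (0 , refl)))
            (sym (dec-false (even? o) (λ even-o → even∧odd⇒⊥ (even-+2 even-o)
              (subst Odd (sym (trans o+2≡n+1 (+-comm n 1))) (even⇒odd-suc even-n)))))
          wrapping {suc (suc _)} (s≤s (s≤s ()))
        L0≡L1 : L 0 ≡ L 1
        L0≡L1 = offset-label-constant 0 L frame-preserves window-preserves 0<n 1<n

      two-missing-windows⇒⊥ : Odd n → ∀ {a c} → F a ≡ false → F c ≡ false → ⟦ a ⟧ ≢ ⟦ c ⟧ → ⊥
      two-missing-windows⇒⊥ odd-n {a} {c} Fa Fc ⟦a⟧≢⟦c⟧ = by-parity (even-or-odd m)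
        where
        m : ℕ
        m = offset ⟦ a ⟧ ⟦ c ⟧
        m<n : m < n
        m<n = offset<n ⟦ a ⟧ ⟦ c ⟧
        m≢0 : m ≢ 0
        m≢0 m≡0 = ⟦a⟧≢⟦c⟧ (trans (cong ⟦_⟧ (sym (+-identityʳ a))) (trans (cong (λ o → ⟦ a + o ⟧) (sym m≡0)) (⟦p+offset⟧ a ⟦ c ⟧)))
        Fa+m : F (a + m) ≡ false
        Fa+m = trans (cong (λ v → H (window v)) (⟦p+offset⟧ a ⟦ c ⟧)) Fc
        Fc+[n∸m] : F (c + (n ∸ m)) ≡ false
        Fc+[n∸m] = trans (cong (λ v → H (window v)) (begin
          ⟦ c + (n ∸ m) ⟧        ≡⟨ sym (⟦⟧+ᵥ c (n ∸ m)) ⟩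
          ⟦ c ⟧ +ᵥ (n ∸ m)       ≡⟨ cong (_+ᵥ (n ∸ m)) (sym (⟦p+offset⟧ a ⟦ c ⟧)) ⟩
          ⟦ a + m ⟧ +ᵥ (n ∸ m)   ≡⟨ ⟦⟧+ᵥ (a + m) (n ∸ m) ⟩
          ⟦ a + m + (n ∸ m) ⟧    ≡⟨ cong ⟦_⟧ (trans (+-assoc a m (n ∸ m)) (cong (a +_) (m+[n∸m]≡n (<⇒≤ m<n)))) ⟩
          ⟦ a + n ⟧              ≡⟨ ⟦p+n⟧ a ⟩
          ⟦ a ⟧                  ∎)) Fa
          where open ≡-Reasoning
        by-parity : Even m ⊎ Odd m → ⊥
        by-parity (inj₁ even-m) = ¬even-gap even-m (even-≢0⇒2≤ even-m m≢0) m<n (Fa , Fa+m , λ t _ _ → no-frames (a + t))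
        by-parity (inj₂ odd-m) = ¬even-gap even-n∸m (even-≢0⇒2≤ even-n∸m n∸m≢0) (∸-monoʳ-< {n} {m} {0} (n≢0⇒n>0 m≢0) (<⇒≤ m<n))
          (Fc , Fc+[n∸m] , λ t _ _ → no-frames (c + t))
          where
          even-n∸m : Even (n ∸ m)
          even-n∸m = odd∸odd odd-m odd-n
          n∸m≢0 : n ∸ m ≢ 0
          n∸m≢0 n∸m≡0 = <⇒≱ m<n (m∸n≡0⇒m≤n n∸m≡0)

      classified-odd : ∀ {h} → n ≡ gap h → ∀ {a} → F a ≡ false → Classified
      classified-odd {h} n≡ {a} Fa = h , ≤-reflexive (sym n≡) , ⟦ a ⟧ ,
        ⊆ᴱ-antisym (⊆S {h} H⊆S) (λ x Sx → S⊆H x (S⇒InS {h} x Sx))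
        where
        H⊆S : SubgraphOfS h ⟦ a ⟧ H
        H⊆S = Gap⇒SubgraphOfS {h} (Fa , trans (cong (λ d → F (a + d)) (sym n≡)) (trans (F-+n a) Fa) ,
                                   λ t _ _ → no-frames (a + t))
        S⊆H : ∀ x → InS h ⟦ a ⟧ x → H x ≡ true
        S⊆H (frame v) (_ , _ , ¬run) with offset ⟦ a ⟧ v ≟ 0
        ... | yes o≡0 = ⊥-elim (¬run n 0<n (≤-reflexive n≡)
              (cong frame (trans (offset≡⇒≡ ⟦ a ⟧ o≡0) (trans (⟦toℕ+0⟧ ⟦ a ⟧) (sym (⟦toℕ+n⟧ ⟦ a ⟧))))))
        ... | no o≢0 = ⊥-elim (¬run (offset ⟦ a ⟧ v) (n≢0⇒n>0 o≢0) (subst (offset ⟦ a ⟧ v ≤_) n≡ (<⇒≤ (offset<n ⟦ a ⟧ v)))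
              (cong frame (offset≡⇒≡ ⟦ a ⟧ refl)))
        S⊆H (window v) (v≢a , _ , _) = trans (F-toℕ v) (¬-not (λ Fv → two-missing-windows⇒⊥ (h , n≡) Fa Fv
          (λ ⟦a⟧≡⟦v⟧ → v≢a (cong window (trans (sym (⟦toℕ⟧ v)) (sym ⟦a⟧≡⟦v⟧))))))

    frameless : (∀ p → E p ≡ false) → (n % 2 ≡ 1 → ¬ IsWindowCycle H) → Classified
    frameless no-frames ¬window-cycle with even-or-odd n
    ... | inj₁ even-n = ⊥-elim (Frameless.¬even-n no-frames even-n)
    ... | inj₂ (h , n≡) with least-false F n
    ...   | inj₁ all = ⊥-elim (¬window-cycle (odd⇒%2≡1 (h , n≡))
              (λ i → trans (F-toℕ i) (F-periodic all _) , trans (E-toℕ i) (no-frames _)))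
    ...   | inj₂ (a , _ , Fa , _) = Frameless.classified-odd no-frames {h} n≡ Fa

    all-frames⇒full : (∀ i → i < n → E i ≡ true) → IsFull H
    all-frames⇒full all (frame v) = trans (E-toℕ v) (E-periodic all _)
    all-frames⇒full all (window v) = trans (F-toℕ v) (frames⇒window (E-periodic all _) (E-periodic all _))

    with-frame : ∀ {a} → a < n → E a ≡ true → ¬ IsFull H → Classified
    with-frame {a} a<n Ea ¬full with least-false E n
    ... | inj₁ all = ⊥-elim (¬full (all-frames⇒full all))
    ... | inj₂ (m , _ , Em , _) with frame-end-between (n ∸ a + m) Ea (trans (E-around m a<n) Em)
    ...   | i , _ , Ea+i , E-suc = FromFrameEnd.classified Ea+i E-suc

    classify : Nontrivial H → Classified
    classify (¬full , ¬window-cycle) with least-false (λ p → not (E p)) n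
    ... | inj₂ (a , a<n , ¬Ea , _) = with-frame a<n (not-injective ¬Ea) ¬full
    ... | inj₁ none = frameless (E-periodic (λ i i<n → not-injective (none i i<n))) ¬window-cycle

  tree⊆S : (G : Subgraph n) → IsTree G → Σ ℕ λ k → k ≤ kmax n × Σ (Fin n) λ j → SpanningTreeOfS k j G
  tree⊆S G tree@(_ , acyclic) with Existence.has-gap G acyclic
  ... | k , gap≤n , p , gap-at-p = k , gap≤⇒≤kmax gap≤n , ⟦ p ⟧ , Positions.Gap⇒SubgraphOfS G {k} gap-at-p , tree

  tree⊆S-unique : (G : Subgraph n) (k k' : ℕ) (j j' : Fin n) → k ≤ kmax n → k' ≤ kmax n →
    SpanningTreeOfS k j G → SpanningTreeOfS k' j' G → k ≡ k' × j ≡ j'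
  tree⊆S-unique G k k' j j' k≤kmax k'≤kmax (G⊆S , connected , _) (G⊆S' , _) =
    S-unique connected {k} {k'} (≤kmax⇒gap≤ 0<n k≤kmax) (≤kmax⇒gap≤ 0<n k'≤kmax) G⊆S G⊆S'

  unique-convex-cover : (G : Subgraph n) → IsTree G →
    Σ (Subgraph n) λ H →
      ((Nontrivial H × Connected H × Convex H) × G ⊆ᴱ H) ×
      ((H' : Subgraph n) → (Nontrivial H' × Connected H' × Convex H') × G ⊆ᴱ H' → ∀ x → H' x ≡ H x)
  unique-convex-cover G tree with tree⊆S G tree
  ... | k , k≤kmax , j , G⊆S , (connected , _) =
        S k j , ((SG.nontrivial , SG.connected , SG.convex) , ⊆S {k} G⊆S) , only
    where
    gap≤n : gap k ≤ n
    gap≤n = ≤kmax⇒gap≤ 0<n k≤kmax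
    module SG = S-graph k j gap≤n
    only : (H' : Subgraph n) → (Nontrivial H' × Connected H' × Convex H') × G ⊆ᴱ H' → ∀ x → H' x ≡ S k j x
    only H' ((nontrivial , connected' , convex') , G⊆H') with Classification.classify H' connected' convex' nontrivial
    ... | q , gap-q≤n , j' , H'≡S with S-unique connected {q} {k} gap-q≤n gap≤n
                                         (λ x Gx → S⇒InS {q} x (trans (sym (H'≡S x)) (G⊆H' x Gx))) G⊆S
    ...   | refl , refl = H'≡S

theorem4p1 : (n : ℕ) {{_ : NonZero n}} → 5 ≤ n →
      ((G : Subgraph n) → IsTree G →
        Σ (Subgraph n) λ H →
          ((Nontrivial H × Connected H × Convex H) × G ⊆ᴱ H) ×
          ((H' : Subgraph n) → (Nontrivial H' × Connected H' × Convex H') × G ⊆ᴱ H' →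
            ∀ x → H' x ≡ H x))
    × ((G : Subgraph n) → IsTree G →
        Σ ℕ λ k → k ≤ kmax n × Σ (Fin n) λ j → SpanningTreeOfS k j G)
    × ((G : Subgraph n) (k k' : ℕ) (j j' : Fin n) → k ≤ kmax n → k' ≤ kmax n →
        SpanningTreeOfS k j G → SpanningTreeOfS k' j' G → k ≡ k' × j ≡ j')
theorem4p1 n n≥5 = unique-convex-cover , tree⊆S , tree⊆S-unique
  where open Square n n≥5
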